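{- Let $q,u,v,x,y$ be indeterminates (equivalently, generic complex parameters for which no denominator below vanishes) and let $r\ge 0$ be an integer. Then $$\frac{(u;q)_r}{(q;q)_r}\ {}_2\phi_1\!\left[\begin{matrix} q^{ -r},\ ux\\ q^{1-r}/ux\end{matrix};q,\frac{qv}{u^2x}\right] =\sum_{i=0}^{\lfloor r/2\rfloor}\frac{(u;q)_{r-2i}}{(q;q)_{r-2i}}\ {}_2\phi_1\!\left[\begin{matrix} q^{2i-r},\ uy\\ q^{1+2i-r}/uy\end{matrix};q,\frac{qv}{u^2y}\right]\, y^i v^i\,\frac{(x/y;q)_i}{(q;q)_i}\,\frac{(uq^{r-2i};q)_{2i}}{(uxq^{r-i};q)_i\,(uyq^{r-2i+1};q)_i}.$$
   Context: For an indeterminate $a$ and integer $k\ge 0$, $(a;q)_k=\prod_{j=0}^{k-1}(1-aq^j)$. The basic hypergeometric series is ${}_{s+1}\phi_s\!\left[\begin{matrix}a_1,\dots,a_{s+1}\\ b_1,\dots,b_s\end{matrix};q,z\right]=\sum_{i\ge0}\frac{(a_1;q)_i\cdots(a_{s+1};q)_i}{(b_1;q)_i\cdots(b_s;q)_i}\frac{z^i}{(q;q)_i}$; when some $a_j=q^{ -m}$ with $m\ge0$ an integer, the series terminates at $i=m$. -}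

module Defs where

open import Level using (Level; _⊔_) renaming (suc to lsuc)
open import Algebra.Bundles using (CommutativeRing)
open import Relation.Nullary using (¬_)
open import Data.Nat as ℕ using (ℕ; zero; suc)

-- The inverse is a total operation; its value
-- at 0 is unspecified (never used under the nonvanishing hypotheses).
record Field (c ℓ : Level) : Set (lsuc (c ⊔ ℓ)) where
  field
    commutativeRing : CommutativeRing c ℓ
  open CommutativeRing commutativeRing public
  field
    _⁻¹        : Carrier → Carrier
    ⁻¹-inverse : ∀ a → ¬ (a ≈ 0#) → a * (a ⁻¹) ≈ 1#
    0≉1        : ¬ (0# ≈ 1#)

module FieldOps {c ℓ : Level} (F : Field c ℓ) where
  open Field F

  infixr 8 _^_
  _^_ : Carrier → ℕ → Carrier
  a ^ zero  = 1#
  a ^ suc n = a * (a ^ n)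

  _÷_ : Carrier → Carrier → Carrier
  a ÷ b = a * (b ⁻¹)

  sumTo : ℕ → (ℕ → Carrier) → Carrier
  sumTo zero    f = f 0
  sumTo (suc n) f = sumTo n f + f (suc n)

  poch : (q a : Carrier) → ℕ → Carrier
  poch q a zero    = 1#
  poch q a (suc k) = poch q a k * (1# - a * q ^ k)

  -- terminating 2φ1[a1, a2; b; q, z] with a1 = q^{-m}: sum over i = 0..m
  phi21 : (q a1 a2 b z : Carrier) (m : ℕ) → Carrier
  phi21 q a1 a2 b z m =
    sumTo m (λ i → (poch q a1 i * poch q a2 i * z ^ i) ÷ (poch q b i * poch q q i))

  qneg : Carrier → ℕ → Carrier
  qneg q m = (q ⁻¹) ^ m

module Submission where

open import Defs
open import Level using (Level)
open import Relation.Nullary using (¬_)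
open import Data.Product using (_×_)
open import Data.Nat as ℕ using (ℕ; _≤_; ⌊_/2⌋)

open import Algebra.Bundles using (CommutativeRing)
open import Algebra.Solver.Ring.AlmostCommutativeRing using (fromCommutativeRing; _-Raw-AlmostCommutative⟶_)
open import Data.Empty using (⊥-elim)
open import Data.Integer as ℤ using (ℤ; +_; -[1+_]; ∣_∣; sign; _◃_; _⊖_)
import Data.Integer.Properties as ℤ
open import Data.List using (_∷_; [])
open import Data.Maybe using (Maybe; just; nothing)
open import Data.Nat using (zero; suc; _<_; _∸_; _⊓_; z≤n; s≤s)
import Data.Nat.Properties as ℕ
open import Data.Nat.Tactic.RingSolver using () renaming (solve to ℕ-solve)
open import Data.Product using (proj₁; proj₂)
open import Data.Sign as Sign using (Sign)
open import Data.Sum using (inj₁; inj₂)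
open import Relation.Nullary using (yes; no)
open import Relation.Binary.PropositionalEquality as ≡ using (_≡_)

-- Write b = uy, w = x/y, A = bw = ux and t = v/u. Reading the factors of the terminating
-- series backwards, (q^{-m};q)_j (qv/(uX))^j / (q^{1-m}/X;q)_j = t^j (q;q)_m / ((q;q)_{m-j} (Xq^{m-j};q)_j),
-- so the left-hand side is Σ_k (u;q)_r t^k α(r-k, k) with α(n,k) = (A;q)_k / ((q;q)_k (q;q)_n (Aq^n;q)_k),
-- and, since (u;q)_{r-2i} (uq^{r-2i};q)_{2i} = (u;q)_r, the (i,j) term of the right-hand side is
-- (u;q)_r t^{i+j} β(i, j, r-2i-j). Collecting powers of t leaves Σ_i β(i, k-i, n-i) = α(n,k)
-- for n + k ≤ r. For k ≤ n this follows by induction on k from the Wilf–Zeilberger recurrence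
--   (1-q^{k+1}) (1-Aq^{n+k}) β(i, k+1-i, n-i) = (1-Aq^k) β(i, k-i, n-i) + G_i - G_{i-1},
-- G_i = -q^{k-i} b (1-wq^i) (1-q^{n-i}) β(i, k-i, n-i) / (1-bq^{n+k-2i}), which telescopes against
-- α(n,k+1) (1-q^{k+1}) (1-Aq^{n+k}) = (1-Aq^k) α(n,k); the case k > n follows from the symmetry of
-- β in its last two arguments and of α. Below, β is summand, α is closedForm and G is certificate.

-- The reflective Tactic.RingSolver takes its coefficients from the ring itself and so cannot
-- cancel 1# - 1# in an abstract ring; Algebra.Solver.Ring is instantiated with ℤ instead.
module IntegerCoefficients {c ℓ : Level} (R : CommutativeRing c ℓ) where

  open CommutativeRing R
  open import Relation.Binary.Reasoning.Setoid setoid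
  open import Algebra.Properties.Ring ring
    using (-‿involutive; -0#≈0#; -1*x≈-x; -‿distribʳ-*; -‿+-comm)
  open import Algebra.Properties.Semiring.Mult.TCOptimised semiring using (×1-homo-*) renaming (_×_ to _×′_)
  open import Algebra.Properties.Monoid.Mult.TCOptimised +-monoid using (×-homo-+)

  ⟦_⟧ℤ : ℤ → Carrier
  ⟦ + n ⟧ℤ      = n ×′ 1#
  ⟦ -[1+ n ] ⟧ℤ = - (suc n ×′ 1#)

  ⊖-homo : ∀ m n → ⟦ m ⊖ n ⟧ℤ ≈ m ×′ 1# - n ×′ 1#
  ⊖-homo m       zero    = trans (sym (+-identityʳ _)) (+-congˡ (sym -0#≈0#))
  ⊖-homo zero    (suc n) = sym (+-identityˡ _)
  ⊖-homo (suc m) (suc n) = begin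
    ⟦ suc m ⊖ suc n ⟧ℤ          ≡⟨ ≡.cong ⟦_⟧ℤ (ℤ.[1+m]⊖[1+n]≡m⊖n m n) ⟩
    ⟦ m ⊖ n ⟧ℤ                  ≈⟨ ⊖-homo m n ⟩
    a - b                       ≈⟨ shift ⟩
    (1# + a) - (1# + b)         ≈⟨ +-cong (×-homo-+ 1# 1 m) (-‿cong (×-homo-+ 1# 1 n)) ⟨
    suc m ×′ 1# - suc n ×′ 1#     ∎
    where
    a = m ×′ 1#
    b = n ×′ 1#
    shift : a - b ≈ (1# + a) - (1# + b)
    shift = begin
      a - b                       ≈⟨ +-congʳ (sym (+-identityˡ a)) ⟩
      (0# + a) - b                ≈⟨ +-congʳ (+-congʳ (sym (-‿inverseʳ 1#))) ⟩
      ((1# - 1#) + a) - b         ≈⟨ +-congʳ (+-assoc 1# (- 1#) a) ⟩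
      (1# + (- 1# + a)) - b       ≈⟨ +-congʳ (+-congˡ (+-comm (- 1#) a)) ⟩
      (1# + (a - 1#)) - b         ≈⟨ +-congʳ (sym (+-assoc 1# a (- 1#))) ⟩
      ((1# + a) - 1#) - b         ≈⟨ +-assoc (1# + a) (- 1#) (- b) ⟩
      (1# + a) + (- 1# - b)       ≈⟨ +-congˡ (-‿+-comm 1# b) ⟩
      (1# + a) - (1# + b)         ∎

  +-homo : ∀ i j → ⟦ i ℤ.+ j ⟧ℤ ≈ ⟦ i ⟧ℤ + ⟦ j ⟧ℤ
  +-homo (+ m)    (+ n)    = ×-homo-+ 1# m n
  +-homo (+ m)    -[1+ n ] = ⊖-homo m (suc n)
  +-homo -[1+ m ] (+ n)    = trans (⊖-homo n (suc m)) (+-comm _ _)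
  +-homo -[1+ m ] -[1+ n ] = begin
    - (suc (suc (m ℕ.+ n)) ×′ 1#)    ≡⟨ ≡.cong (λ k → - (k ×′ 1#)) (≡.sym (ℕ.+-suc (suc m) n)) ⟩
    - ((suc m ℕ.+ suc n) ×′ 1#)      ≈⟨ -‿cong (×-homo-+ 1# (suc m) (suc n)) ⟩
    - (suc m ×′ 1# + suc n ×′ 1#)     ≈⟨ -‿+-comm _ _ ⟨
    - (suc m ×′ 1#) - (suc n ×′ 1#)   ∎

  -‿homo : ∀ i → ⟦ ℤ.- i ⟧ℤ ≈ - ⟦ i ⟧ℤ
  -‿homo (+ zero)  = sym -0#≈0#
  -‿homo (+ suc n) = refl
  -‿homo -[1+ n ]  = sym (-‿involutive _)

  ⟦_⟧± : Sign → Carrier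
  ⟦ Sign.+ ⟧± = 1#
  ⟦ Sign.- ⟧± = - 1#

  sign-homo : ∀ s t → ⟦ s Sign.* t ⟧± ≈ ⟦ s ⟧± * ⟦ t ⟧±
  sign-homo Sign.+ t      = sym (*-identityˡ _)
  sign-homo Sign.- Sign.+ = sym (*-identityʳ _)
  sign-homo Sign.- Sign.- = begin
    1#              ≈⟨ -‿involutive 1# ⟨
    - - 1#          ≈⟨ -‿cong (-1*x≈-x 1#) ⟨
    - (- 1# * 1#)   ≈⟨ -‿distribʳ-* (- 1#) 1# ⟩
    - 1# * - 1#     ∎

  ◃-homo : ∀ s n → ⟦ s ◃ n ⟧ℤ ≈ ⟦ s ⟧± * (n ×′ 1#)
  ◃-homo s      zero    = sym (zeroʳ _)
  ◃-homo Sign.+ (suc n) = sym (*-identityˡ _)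
  ◃-homo Sign.- (suc n) = sym (-1*x≈-x _)

  sign-abs : ∀ i → ⟦ i ⟧ℤ ≈ ⟦ sign i ⟧± * (∣ i ∣ ×′ 1#)
  sign-abs i = trans (≡.subst (λ j → ⟦ i ⟧ℤ ≈ ⟦ j ⟧ℤ) (≡.sym (ℤ.◃-inverse i)) refl) (◃-homo (sign i) ∣ i ∣)

  *-homo : ∀ i j → ⟦ i ℤ.* j ⟧ℤ ≈ ⟦ i ⟧ℤ * ⟦ j ⟧ℤ
  *-homo i j = begin
    ⟦ (sign i Sign.* sign j) ◃ (∣ i ∣ ℕ.* ∣ j ∣) ⟧ℤ
      ≈⟨ ◃-homo (sign i Sign.* sign j) (∣ i ∣ ℕ.* ∣ j ∣) ⟩
    ⟦ sign i Sign.* sign j ⟧± * ((∣ i ∣ ℕ.* ∣ j ∣) ×′ 1#)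
      ≈⟨ *-cong (sign-homo (sign i) (sign j)) (×1-homo-* ∣ i ∣ ∣ j ∣) ⟩
    (⟦ sign i ⟧± * ⟦ sign j ⟧±) * (∣ i ∣ ×′ 1# * ∣ j ∣ ×′ 1#)
      ≈⟨ interchange ⟩
    (⟦ sign i ⟧± * ∣ i ∣ ×′ 1#) * (⟦ sign j ⟧± * ∣ j ∣ ×′ 1#)
      ≈⟨ *-cong (sign-abs i) (sign-abs j) ⟨
    ⟦ i ⟧ℤ * ⟦ j ⟧ℤ ∎
    where
    interchange : ∀ {a b x y} → (a * b) * (x * y) ≈ (a * x) * (b * y)
    interchange {a} {b} {x} {y} = begin
      (a * b) * (x * y)   ≈⟨ *-assoc a b (x * y) ⟩
      a * (b * (x * y))   ≈⟨ *-congˡ (*-assoc b x y) ⟨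
      a * ((b * x) * y)   ≈⟨ *-congˡ (*-congʳ (*-comm b x)) ⟩
      a * ((x * b) * y)   ≈⟨ *-congˡ (*-assoc x b y) ⟩
      a * (x * (b * y))   ≈⟨ *-assoc a x (b * y) ⟨
      (a * x) * (b * y)   ∎

  morphism : ℤ.+-*-rawRing -Raw-AlmostCommutative⟶ fromCommutativeRing R
  morphism = record
    { ⟦_⟧ = ⟦_⟧ℤ ; +-homo = +-homo ; *-homo = *-homo ; -‿homo = -‿homo ; 0-homo = refl ; 1-homo = refl }

  ⟦⟧ℤ-equal? : ∀ i j → Maybe (⟦ i ⟧ℤ ≈ ⟦ j ⟧ℤ)
  ⟦⟧ℤ-equal? i j with i ℤ.≟ j
  ... | yes ≡.refl = just refl
  ... | no _       = nothing

  open import Algebra.Solver.Ring ℤ.+-*-rawRing (fromCommutativeRing R) morphism ⟦⟧ℤ-equal? public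
    using (Polynomial; solve; _:=_; con; _:+_; _:*_; _:-_; :-_)

  𝟙 : ∀ {n} → Polynomial n
  𝟙 = con (+ 1)

module FieldProperties {c ℓ : Level} (F : Field c ℓ) where

  open Field F
  open FieldOps F
  open import Relation.Binary.Reasoning.Setoid setoid
  open IntegerCoefficients commutativeRing public
  open import Algebra.Solver.CommutativeMonoid *-commutativeMonoid public
    using () renaming (solve to rearrange; _⊕_ to infixl 7 _∙_; _⊜_ to _≣_; id to ι)

  infix 4 _≉0
  _≉0 : Carrier → Set ℓ
  x ≉0 = ¬ (x ≈ 0#)

  ≉0-resp : ∀ {x y} → x ≈ y → x ≉0 → y ≉0
  ≉0-resp x≈y x≉0 y≈0 = x≉0 (trans x≈y y≈0)

  ⁻¹-inverseˡ : ∀ {x} → x ≉0 → x ⁻¹ * x ≈ 1#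
  ⁻¹-inverseˡ {x} x≉0 = trans (*-comm (x ⁻¹) x) (⁻¹-inverse x x≉0)

  *-cancelˡ : ∀ {d x y} → d ≉0 → d * x ≈ d * y → x ≈ y
  *-cancelˡ {d} {x} {y} d≉0 eq = begin
    x                 ≈⟨ *-identityˡ x ⟨
    1# * x            ≈⟨ *-congʳ (⁻¹-inverseˡ d≉0) ⟨
    (d ⁻¹ * d) * x    ≈⟨ *-assoc (d ⁻¹) d x ⟩
    d ⁻¹ * (d * x)    ≈⟨ *-congˡ eq ⟩
    d ⁻¹ * (d * y)    ≈⟨ *-assoc (d ⁻¹) d y ⟨
    (d ⁻¹ * d) * y    ≈⟨ *-congʳ (⁻¹-inverseˡ d≉0) ⟩
    1# * y            ≈⟨ *-identityˡ y ⟩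
    y                 ∎

  *-cancelʳ : ∀ {d x y} → d ≉0 → x * d ≈ y * d → x ≈ y
  *-cancelʳ {d} {x} {y} d≉0 eq = *-cancelˡ d≉0 (trans (*-comm d x) (trans eq (*-comm y d)))

  *-≉0 : ∀ {x y} → x ≉0 → y ≉0 → x * y ≉0
  *-≉0 {x} {y} x≉0 y≉0 xy≈0 = y≉0 (*-cancelˡ x≉0 (trans xy≈0 (sym (zeroʳ x))))

  ≉0-*ˡ : ∀ {x y} → x * y ≉0 → x ≉0
  ≉0-*ˡ {x} {y} xy≉0 x≈0 = xy≉0 (trans (*-congʳ x≈0) (zeroˡ y))

  ≉0-*ʳ : ∀ {x y} → x * y ≉0 → y ≉0
  ≉0-*ʳ {x} {y} xy≉0 y≈0 = xy≉0 (trans (*-congˡ y≈0) (zeroʳ x))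

  ⁻¹-unique : ∀ {x y} → x ≉0 → x * y ≈ 1# → y ≈ x ⁻¹
  ⁻¹-unique {x} {y} x≉0 xy≈1 = *-cancelˡ x≉0 (trans xy≈1 (sym (⁻¹-inverse x x≉0)))

  ⁻¹-cong : ∀ {x y} → x ≉0 → x ≈ y → x ⁻¹ ≈ y ⁻¹
  ⁻¹-cong {x} {y} x≉0 x≈y =
    ⁻¹-unique (≉0-resp x≈y x≉0) (trans (*-congʳ (sym x≈y)) (⁻¹-inverse x x≉0))

  ⁻¹-distrib-* : ∀ {x y} → x ≉0 → y ≉0 → (x * y) ⁻¹ ≈ x ⁻¹ * y ⁻¹
  ⁻¹-distrib-* {x} {y} x≉0 y≉0 = sym (⁻¹-unique (*-≉0 x≉0 y≉0) (begin
    (x * y) * (x ⁻¹ * y ⁻¹)      ≈⟨ rearrange 4 (λ x y x' y' → (x ∙ y) ∙ (x' ∙ y') ≣ (x ∙ x') ∙ (y ∙ y'))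
                                         refl x y (x ⁻¹) (y ⁻¹) ⟩
    (x * x ⁻¹) * (y * y ⁻¹)      ≈⟨ *-cong (⁻¹-inverse x x≉0) (⁻¹-inverse y y≉0) ⟩
    1# * 1#                      ≈⟨ *-identityˡ 1# ⟩
    1#                           ∎))

  ÷-*-cancel : ∀ {d} a → d ≉0 → (a ÷ d) * d ≈ a
  ÷-*-cancel {d} a d≉0 = begin
    (a * d ⁻¹) * d    ≈⟨ *-assoc a (d ⁻¹) d ⟩
    a * (d ⁻¹ * d)    ≈⟨ *-congˡ (⁻¹-inverseˡ d≉0) ⟩
    a * 1#            ≈⟨ *-identityʳ a ⟩
    a                 ∎

  ÷-*-cross : ∀ {n₁ n₂ d₁ d₂ m₁ m₂} → d₁ ≉0 → d₂ ≉0 →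
            n₁ * d₂ * m₁ ≈ n₂ * d₁ * m₂ → (n₁ ÷ d₁) * m₁ ≈ (n₂ ÷ d₂) * m₂
  ÷-*-cross {n₁} {n₂} {d₁} {d₂} {m₁} {m₂} d₁≉0 d₂≉0 eq = *-cancelʳ (*-≉0 d₁≉0 d₂≉0) (begin
    (n₁ ÷ d₁) * m₁ * (d₁ * d₂)     ≈⟨ rearrange 4 (λ f d₁ d₂ m₁ → f ∙ m₁ ∙ (d₁ ∙ d₂) ≣ (f ∙ d₁) ∙ d₂ ∙ m₁)
                                         refl (n₁ ÷ d₁) d₁ d₂ m₁ ⟩
    (n₁ ÷ d₁) * d₁ * d₂ * m₁       ≈⟨ *-congʳ (*-congʳ (÷-*-cancel n₁ d₁≉0)) ⟩
    n₁ * d₂ * m₁                   ≈⟨ eq ⟩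
    n₂ * d₁ * m₂                   ≈⟨ *-congʳ (*-congʳ (÷-*-cancel n₂ d₂≉0)) ⟨
    (n₂ ÷ d₂) * d₂ * d₁ * m₂       ≈⟨ rearrange 4 (λ f d₁ d₂ m₂ → f ∙ d₂ ∙ d₁ ∙ m₂ ≣ f ∙ m₂ ∙ (d₁ ∙ d₂))
                                         refl (n₂ ÷ d₂) d₁ d₂ m₂ ⟩
    (n₂ ÷ d₂) * m₂ * (d₁ * d₂)     ∎)

  ÷-cong : ∀ {a a′ d d′} → d ≉0 → a ≈ a′ → d ≈ d′ → a ÷ d ≈ a′ ÷ d′
  ÷-cong d≉0 a≈a′ d≈d′ = *-cong a≈a′ (⁻¹-cong d≉0 d≈d′)

  ÷-cross : ∀ {n₁ n₂ d₁ d₂} → d₁ ≉0 → d₂ ≉0 → n₁ * d₂ ≈ n₂ * d₁ → n₁ ÷ d₁ ≈ n₂ ÷ d₂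
  ÷-cross {n₁} {n₂} {d₁} {d₂} d₁≉0 d₂≉0 eq = begin
    n₁ ÷ d₁          ≈⟨ *-identityʳ _ ⟨
    (n₁ ÷ d₁) * 1#   ≈⟨ ÷-*-cross d₁≉0 d₂≉0 (trans (*-identityʳ _) (trans eq (sym (*-identityʳ _)))) ⟩
    (n₂ ÷ d₂) * 1#   ≈⟨ *-identityʳ _ ⟩
    n₂ ÷ d₂          ∎

  ÷-*-÷ : ∀ {b d} a c → b ≉0 → d ≉0 → (a ÷ b) * (c ÷ d) ≈ (a * c) ÷ (b * d)
  ÷-*-÷ {b} {d} a c b≉0 d≉0 = begin
    a * b ⁻¹ * (c * d ⁻¹)    ≈⟨ rearrange 4 (λ a b′ c d′ → a ∙ b′ ∙ (c ∙ d′) ≣ a ∙ c ∙ (b′ ∙ d′)) refl a (b ⁻¹) c (d ⁻¹) ⟩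
    a * c * (b ⁻¹ * d ⁻¹)    ≈⟨ *-congˡ (⁻¹-distrib-* b≉0 d≉0) ⟨
    a * c * (b * d) ⁻¹       ∎

module Powers {c ℓ : Level} (F : Field c ℓ) where

  open Field F
  open FieldOps F
  open FieldProperties F using (rearrange; _∙_; _≣_)

  ^-cong : ∀ {x y} n → x ≈ y → x ^ n ≈ y ^ n
  ^-cong zero    x≈y = refl
  ^-cong (suc n) x≈y = *-cong x≈y (^-cong n x≈y)

  ^-+ : ∀ x m n → x ^ (m ℕ.+ n) ≈ x ^ m * x ^ n
  ^-+ x zero    n = sym (*-identityˡ _)
  ^-+ x (suc m) n = trans (*-congˡ (^-+ x m n)) (sym (*-assoc x (x ^ m) (x ^ n)))

  ^-distrib-* : ∀ x y n → (x * y) ^ n ≈ x ^ n * y ^ n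
  ^-distrib-* x y zero    = sym (*-identityˡ 1#)
  ^-distrib-* x y (suc n) = trans (*-congˡ (^-distrib-* x y n))
    (rearrange 4 (λ x y xn yn → (x ∙ y) ∙ (xn ∙ yn) ≣ (x ∙ xn) ∙ (y ∙ yn)) refl x y (x ^ n) (y ^ n))

  1^n≈1 : ∀ n → 1# ^ n ≈ 1#
  1^n≈1 zero    = refl
  1^n≈1 (suc n) = trans (*-identityˡ _) (1^n≈1 n)

module Pochhammer {c ℓ : Level} (F : Field c ℓ) (q : Field.Carrier F) where

  open Field F
  open FieldOps F
  open FieldProperties F
  open Powers F
  open import Relation.Binary.Reasoning.Setoid setoid

  poch-cong : ∀ {x y} n → x ≈ y → poch q x n ≈ poch q y n
  poch-cong zero    x≈y = refl
  poch-cong (suc n) x≈y = *-cong (poch-cong n x≈y) (+-congˡ (-‿cong (*-congʳ x≈y)))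

  poch-sucˡ : ∀ x n → poch q x (suc n) ≈ (1# - x) * poch q (x * q) n
  poch-sucˡ x zero = solve 1 (λ x → 𝟙 :* (𝟙 :- x :* 𝟙) := (𝟙 :- x) :* 𝟙) refl x
  poch-sucˡ x (suc n) = begin
    poch q x (suc n) * (1# - x * q ^ suc n)                 ≈⟨ *-congʳ (poch-sucˡ x n) ⟩
    (1# - x) * poch q (x * q) n * (1# - x * (q * q ^ n))    ≈⟨ *-assoc _ _ _ ⟩
    (1# - x) * (poch q (x * q) n * (1# - x * (q * q ^ n)))  ≈⟨ *-congˡ (*-congˡ (+-congˡ (-‿cong (sym (*-assoc x q (q ^ n)))))) ⟩
    (1# - x) * poch q (x * q) (suc n)                       ∎

  poch-+ : ∀ x m n → poch q x (m ℕ.+ n) ≈ poch q x m * poch q (x * q ^ m) n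
  poch-+ x zero    n = trans (poch-cong n (sym (*-identityʳ x))) (sym (*-identityˡ _))
  poch-+ x (suc m) n = begin
    poch q x (suc (m ℕ.+ n))                                  ≈⟨ poch-sucˡ x (m ℕ.+ n) ⟩
    (1# - x) * poch q (x * q) (m ℕ.+ n)                       ≈⟨ *-congˡ (poch-+ (x * q) m n) ⟩
    (1# - x) * (poch q (x * q) m * poch q (x * q * q ^ m) n)  ≈⟨ *-assoc _ _ _ ⟨
    (1# - x) * poch q (x * q) m * poch q (x * q * q ^ m) n    ≈⟨ *-cong (sym (poch-sucˡ x m)) (poch-cong n (*-assoc x q (q ^ m))) ⟩
    poch q x (suc m) * poch q (x * q ^ suc m) n               ∎

  poch-+-comm : ∀ x m n → poch q x m * poch q (x * q ^ m) n ≈ poch q x n * poch q (x * q ^ n) m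
  poch-+-comm x m n =
    trans (sym (poch-+ x m n)) (trans (reflexive (≡.cong (poch q x) (ℕ.+-comm m n))) (poch-+ x n m))

  poch-≉0 : ∀ x n → (∀ j → j < n → 1# - x * q ^ j ≉0) → poch q x n ≉0
  poch-≉0 x zero    factors≉0 = λ 1≈0 → 0≉1 (sym 1≈0)
  poch-≉0 x (suc n) factors≉0 =
    *-≉0 (poch-≉0 x n (λ j j<n → factors≉0 j (ℕ.m<n⇒m<1+n j<n))) (factors≉0 n ℕ.≤-refl)

  poch-factor-≉0 : ∀ x n → poch q x n ≉0 → ∀ j → j < n → 1# - x * q ^ j ≉0
  poch-factor-≉0 x (suc n) p≉0 j j<1+n with ℕ.m≤n⇒m<n∨m≡n (ℕ.≤-pred j<1+n)
  ... | inj₁ j<n    = poch-factor-≉0 x n (≉0-*ˡ p≉0) j j<n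
  ... | inj₂ ≡.refl = ≉0-*ʳ p≉0

  Regular : Carrier → ℕ → Set ℓ
  Regular x m = ∀ e → e < m → 1# - x * q ^ e ≉0

  regular-factor-≉0 : ∀ {x y m} e → Regular x m → e < m → x * q ^ e ≈ y → 1# - y ≉0
  regular-factor-≉0 e reg e<m eq = ≉0-resp (+-congˡ (-‿cong eq)) (reg e e<m)

  regular-poch-≉0 : ∀ {x y m} e n → Regular x m → e ℕ.+ n ≤ m → x * q ^ e ≈ y → poch q y n ≉0
  regular-poch-≉0 {x} {y} e n reg e+n≤m eq = poch-≉0 y n (λ j j<n →
    regular-factor-≉0 (e ℕ.+ j) reg (ℕ.<-≤-trans (ℕ.+-monoʳ-< e j<n) e+n≤m)
      (trans (*-congˡ (^-+ q e j)) (trans (sym (*-assoc x _ _)) (*-congʳ eq))))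

  regular-cong : ∀ {x y m} → x ≈ y → Regular x m → Regular y m
  regular-cong x≈y reg e e<m = ≉0-resp (+-congˡ (-‿cong (*-congʳ x≈y))) (reg e e<m)

2*m≡m+m : ∀ m → 2 ℕ.* m ≡ m ℕ.+ m
2*m≡m+m m = ≡.cong (m ℕ.+_) (ℕ.+-identityʳ m)

m≤⌊n/2⌋⇒2*m≤n : ∀ {m n} → m ≤ ⌊ n /2⌋ → 2 ℕ.* m ≤ n
m≤⌊n/2⌋⇒2*m≤n {m} {n} m≤h = ≡.subst₂ _≤_ (≡.sym (2*m≡m+m m)) (ℕ.⌊n/2⌋+⌈n/2⌉≡n n)
  (ℕ.+-mono-≤ m≤h (ℕ.≤-trans m≤h (ℕ.⌊n/2⌋≤⌈n/2⌉ n)))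

2*m≤n⇒m≤⌊n/2⌋ : ∀ {m n} → 2 ℕ.* m ≤ n → m ≤ ⌊ n /2⌋
2*m≤n⇒m≤⌊n/2⌋ {m} {n} 2m≤n =
  ≡.subst (_≤ ⌊ n /2⌋) (≡.sym (ℕ.n≡⌊n+n/2⌋ m)) (ℕ.⌊n/2⌋-mono (≡.subst (_≤ n) (2*m≡m+m m) 2m≤n))

∸-half : ∀ {i j ν r} → 2 ℕ.* i ≤ r → j ℕ.+ ν ≡ r ∸ 2 ℕ.* i → r ∸ i ≡ i ℕ.+ j ℕ.+ ν
∸-half {i} {j} {ν} {r} 2i≤r j+ν≡ = begin
  r ∸ i                           ≡⟨ ≡.cong (_∸ i) (ℕ.m+[n∸m]≡n 2i≤r) ⟨
  (2 ℕ.* i ℕ.+ (r ∸ 2 ℕ.* i)) ∸ i  ≡⟨ ≡.cong (λ e → e ℕ.+ (r ∸ 2 ℕ.* i) ∸ i) (2*m≡m+m i) ⟩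
  (i ℕ.+ i ℕ.+ (r ∸ 2 ℕ.* i)) ∸ i  ≡⟨ ≡.cong (_∸ i) (ℕ.+-assoc i i _) ⟩
  (i ℕ.+ (i ℕ.+ (r ∸ 2 ℕ.* i))) ∸ i ≡⟨ ℕ.m+n∸m≡n i _ ⟩
  i ℕ.+ (r ∸ 2 ℕ.* i)              ≡⟨ ≡.cong (i ℕ.+_) j+ν≡ ⟨
  i ℕ.+ (j ℕ.+ ν)                  ≡⟨ ℕ.+-assoc i j ν ⟨
  i ℕ.+ j ℕ.+ ν                    ∎
  where open ≡.≡-Reasoning

module FiniteSums {c ℓ : Level} (F : Field c ℓ) where

  open Field F
  open FieldOps F
  open FieldProperties F using (solve; _:=_; con; _:+_; _:*_; :-_)
  open import Relation.Binary.Reasoning.Setoid setoid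

  sumTo-cong : ∀ {f g} n → (∀ i → i ≤ n → f i ≈ g i) → sumTo n f ≈ sumTo n g
  sumTo-cong zero    f≈g = f≈g 0 z≤n
  sumTo-cong (suc n) f≈g = +-cong (sumTo-cong n (λ i i≤n → f≈g i (ℕ.m≤n⇒m≤1+n i≤n))) (f≈g (suc n) ℕ.≤-refl)

  sumTo-*ˡ : ∀ a f n → a * sumTo n f ≈ sumTo n (λ i → a * f i)
  sumTo-*ˡ a f zero    = refl
  sumTo-*ˡ a f (suc n) = trans (distribˡ a _ _) (+-congʳ (sumTo-*ˡ a f n))

  sumTo-*ʳ : ∀ a f n → sumTo n f * a ≈ sumTo n (λ i → f i * a)
  sumTo-*ʳ a f n = trans (*-comm _ a) (trans (sumTo-*ˡ a f n) (sumTo-cong n (λ i _ → *-comm a (f i))))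

  sumTo-+ : ∀ f g n → sumTo n f + sumTo n g ≈ sumTo n (λ i → f i + g i)
  sumTo-+ f g zero    = refl
  sumTo-+ f g (suc n) = trans
    (solve 4 (λ a b x y → (a :+ x) :+ (b :+ y) := (a :+ b) :+ (x :+ y)) refl (sumTo n f) (sumTo n g) (f (suc n)) (g (suc n)))
    (+-congʳ (sumTo-+ f g n))

  sumTo-extend : ∀ f {m} n → m ≤ n → (∀ i → m < i → i ≤ n → f i ≈ 0#) → sumTo n f ≈ sumTo m f
  sumTo-extend f n m≤n f≈0 with ℕ.m≤n⇒m<n∨m≡n m≤n
  sumTo-extend f n       m≤n f≈0 | inj₂ ≡.refl = refl
  sumTo-extend f {m} (suc n) m≤n f≈0 | inj₁ m<1+n = begin
    sumTo n f + f (suc n)   ≈⟨ +-cong (sumTo-extend f n (ℕ.≤-pred m<1+n) (λ i m<i i≤n → f≈0 i m<i (ℕ.m≤n⇒m≤1+n i≤n)))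
                                      (f≈0 (suc n) m<1+n ℕ.≤-refl) ⟩
    sumTo m f + 0#          ≈⟨ +-identityʳ _ ⟩
    sumTo m f               ∎

  sumTo-antidiagonal : ∀ (f : ℕ → ℕ → Carrier) r →
    sumTo r (λ k → sumTo k (λ i → f i (k ∸ i))) ≈ sumTo r (λ i → sumTo (r ∸ i) (f i))
  sumTo-antidiagonal f zero    = refl
  sumTo-antidiagonal f (suc r) = begin
    sumTo r (λ k → sumTo k (λ i → f i (k ∸ i))) + (sumTo r (λ i → f i (suc r ∸ i)) + f (suc r) (r ∸ r))
      ≈⟨ +-congʳ (sumTo-antidiagonal f r) ⟩
    sumTo r (λ i → sumTo (r ∸ i) (f i)) + (sumTo r (λ i → f i (suc r ∸ i)) + f (suc r) (r ∸ r))
      ≈⟨ +-assoc _ _ _ ⟨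
    sumTo r (λ i → sumTo (r ∸ i) (f i)) + sumTo r (λ i → f i (suc r ∸ i)) + f (suc r) (r ∸ r)
      ≈⟨ +-congʳ (sumTo-+ _ _ r) ⟩
    sumTo r (λ i → sumTo (r ∸ i) (f i) + f i (suc r ∸ i)) + f (suc r) (r ∸ r)
      ≈⟨ +-cong (sumTo-cong r step) (reflexive (≡.cong (f (suc r)) (ℕ.n∸n≡0 r))) ⟩
    sumTo r (λ i → sumTo (suc r ∸ i) (f i)) + f (suc r) 0
      ≡⟨ ≡.cong (λ m → sumTo r (λ i → sumTo (suc r ∸ i) (f i)) + sumTo m (f (suc r))) (ℕ.n∸n≡0 r) ⟨
    sumTo (suc r) (λ i → sumTo (suc r ∸ i) (f i)) ∎
    where
    step : ∀ i → i ≤ r → sumTo (r ∸ i) (f i) + f i (suc r ∸ i) ≈ sumTo (suc r ∸ i) (f i)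
    step i i≤r rewrite ℕ.+-∸-assoc 1 i≤r = refl

  sumTo-telescope : ∀ k (X Y C : ℕ → Carrier) d → C 0 ≈ 0# →
    (∀ i → i ≤ k → X i ≈ d * Y i + C (suc i) - C i) → X (suc k) ≈ - C (suc k) →
    sumTo (suc k) X ≈ d * sumTo k Y
  sumTo-telescope k X Y C d C0≈0 step last = begin
    sumTo k X + X (suc k)                ≈⟨ +-cong (partial k ℕ.≤-refl) last ⟩
    (d * sumTo k Y + C (suc k)) - C (suc k) ≈⟨ solve 2 (λ a c → (a :+ c) :+ :- c := a) refl (d * sumTo k Y) (C (suc k)) ⟩
    d * sumTo k Y                        ∎
    where
    partial : ∀ m → m ≤ k → sumTo m X ≈ d * sumTo m Y + C (suc m)
    partial zero    _ = begin
      X 0                             ≈⟨ step 0 z≤n ⟩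
      d * Y 0 + C 1 - C 0             ≈⟨ +-congˡ (-‿cong C0≈0) ⟩
      d * Y 0 + C 1 - 0#              ≈⟨ solve 1 (λ a → a :+ :- con (+ 0) := a) refl (d * Y 0 + C 1) ⟩
      d * Y 0 + C 1                   ∎
    partial (suc m) m<k = begin
      sumTo m X + X (suc m)           ≈⟨ +-cong (partial m (ℕ.<⇒≤ m<k)) (step (suc m) m<k) ⟩
      (d * sumTo m Y + C (suc m)) + (d * Y (suc m) + C (suc (suc m)) - C (suc m))
        ≈⟨ solve 5 (λ d s c y c′ → (d :* s :+ c) :+ (d :* y :+ c′ :+ :- c) := d :* (s :+ y) :+ c′)
             refl d (sumTo m Y) (C (suc m)) (Y (suc m)) (C (suc (suc m))) ⟩
      d * (sumTo m Y + Y (suc m)) + C (suc (suc m)) ∎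

  sumTo-zero : ∀ f n → (∀ i → i ≤ n → f i ≈ 0#) → sumTo n f ≈ 0#
  sumTo-zero f zero    f≈0 = f≈0 0 z≤n
  sumTo-zero f (suc n) f≈0 = trans (+-cong (sumTo-zero f n (λ i i≤n → f≈0 i (ℕ.m≤n⇒m≤1+n i≤n))) (f≈0 (suc n) ℕ.≤-refl)) (+-identityʳ 0#)

  -- Both sides sum f i k over the pairs with i ≤ k and i + k ≤ r.
  sumTo-strips : ∀ (f : ℕ → ℕ → Carrier) r →
    sumTo ⌊ r /2⌋ (λ i → sumTo (r ∸ 2 ℕ.* i) (λ j → f i (i ℕ.+ j)))
      ≈ sumTo r (λ k → sumTo (k ⊓ (r ∸ k)) (λ i → f i k))
  sumTo-strips f r = begin
    sumTo ⌊ r /2⌋ (λ i → sumTo (r ∸ 2 ℕ.* i) (λ j → f i (i ℕ.+ j)))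
      ≈⟨ sumTo-cong ⌊ r /2⌋ (λ i i≤h → sumTo-cong (r ∸ 2 ℕ.* i) (λ j j≤ →
           sym (g-yes i j (≡.subst (_≤ r) (ℕ.+-comm j (2 ℕ.* i)) (ℕ.m≤o∸n⇒m+n≤o j (m≤⌊n/2⌋⇒2*m≤n i≤h) j≤))))) ⟩
    sumTo ⌊ r /2⌋ (λ i → sumTo (r ∸ 2 ℕ.* i) (g i))
      ≈⟨ sumTo-cong ⌊ r /2⌋ (λ i _ → sumTo-extend (g i) (r ∸ i) (ℕ.∸-monoʳ-≤ r (ℕ.m≤m+n i (i ℕ.+ 0)))
           (λ j r-2i<j _ → g-no i j (λ ok → ℕ.<⇒≱ r-2i<j
             (ℕ.m+n≤o⇒m≤o∸n j (≡.subst (_≤ r) (ℕ.+-comm (2 ℕ.* i) j) ok))))) ⟨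
    sumTo ⌊ r /2⌋ (λ i → sumTo (r ∸ i) (g i))
      ≈⟨ sumTo-extend (λ i → sumTo (r ∸ i) (g i)) r (ℕ.⌊n/2⌋≤n r)
           (λ i h<i _ → sumTo-zero (g i) (r ∸ i) (λ j _ → g-no i j (λ ok → ℕ.<⇒≱ h<i (2*m≤n⇒m≤⌊n/2⌋ (ℕ.m+n≤o⇒m≤o (2 ℕ.* i) ok))))) ⟨
    sumTo r (λ i → sumTo (r ∸ i) (g i))
      ≈⟨ sumTo-antidiagonal g r ⟨
    sumTo r (λ k → sumTo k (λ i → g i (k ∸ i)))
      ≈⟨ sumTo-cong r strip ⟩
    sumTo r (λ k → sumTo (k ⊓ (r ∸ k)) (λ i → f i k)) ∎
    where
    g : ℕ → ℕ → Carrier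
    g i j with 2 ℕ.* i ℕ.+ j ℕ.≤? r
    ... | yes _ = f i (i ℕ.+ j)
    ... | no  _ = 0#
    g-yes : ∀ i j → 2 ℕ.* i ℕ.+ j ≤ r → g i j ≈ f i (i ℕ.+ j)
    g-yes i j ok with 2 ℕ.* i ℕ.+ j ℕ.≤? r
    ... | yes _  = refl
    ... | no ¬ok = ⊥-elim (¬ok ok)
    g-no : ∀ i j → ¬ (2 ℕ.* i ℕ.+ j ≤ r) → g i j ≈ 0#
    g-no i j ¬ok with 2 ℕ.* i ℕ.+ j ℕ.≤? r
    ... | yes ok = ⊥-elim (¬ok ok)
    ... | no _   = refl
    split : ∀ {i k} → i ≤ k → 2 ℕ.* i ℕ.+ (k ∸ i) ≡ i ℕ.+ k
    split {i} {k} i≤k = ≡.trans (≡.cong (ℕ._+ (k ∸ i)) (2*m≡m+m i))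
      (≡.trans (ℕ.+-assoc i i (k ∸ i)) (≡.cong (i ℕ.+_) (ℕ.m+[n∸m]≡n i≤k)))
    strip : ∀ k → k ≤ r → sumTo k (λ i → g i (k ∸ i)) ≈ sumTo (k ⊓ (r ∸ k)) (λ i → f i k)
    strip k k≤r = trans
      (sumTo-extend (λ i → g i (k ∸ i)) k (ℕ.m⊓n≤m k (r ∸ k)) (λ i m<i i≤k → g-no i (k ∸ i) (λ ok →
        ℕ.<⇒≱ m<i (ℕ.⊓-glb i≤k (ℕ.m+n≤o⇒m≤o∸n i (≡.subst (_≤ r) (split i≤k) ok))))))
      (sumTo-cong (k ⊓ (r ∸ k)) (λ i i≤ → trans
        (g-yes i (k ∸ i) (≡.subst (_≤ r) (≡.sym (split (ℕ.m≤n⊓o⇒m≤n k (r ∸ k) i≤)))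
          (ℕ.m≤o∸n⇒m+n≤o i k≤r (ℕ.m≤n⊓o⇒m≤o k (r ∸ k) i≤))))
        (reflexive (≡.cong (f i) (ℕ.m+[n∸m]≡n (ℕ.m≤n⊓o⇒m≤n k (r ∸ k) i≤))))))

module Reversal {c ℓ : Level} (F : Field c ℓ) (q : Field.Carrier F) where

  open Field F
  open FieldOps F
  open FieldProperties F
  open Powers F
  open Pochhammer F q
  open FiniteSums F
  open import Relation.Binary.Reasoning.Setoid setoid

  qneg-inverse : q ≉0 → ∀ m → qneg q m * q ^ m ≈ 1#
  qneg-inverse q≉0 zero    = *-identityˡ 1#
  qneg-inverse q≉0 (suc m) = begin
    q ⁻¹ * qneg q m * (q * q ^ m)    ≈⟨ rearrange 4 (λ q′ p q x → q′ ∙ p ∙ (q ∙ x) ≣ (q′ ∙ q) ∙ (p ∙ x)) refl (q ⁻¹) (qneg q m) q (q ^ m) ⟩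
    q ⁻¹ * q * (qneg q m * q ^ m)    ≈⟨ *-cong (⁻¹-inverseˡ q≉0) (qneg-inverse q≉0 m) ⟩
    1# * 1#                          ≈⟨ *-identityˡ 1# ⟩
    1#                               ∎

  -- The factors of (q^{1-m}/X;q)_m are those of (X;q)_m read backwards, up to units.
  reversed-regular : ∀ {X} m → q ≉0 → X ≉0 → poch q ((q * qneg q m) ÷ X) m ≉0 → Regular X m
  reversed-regular {X} m q≉0 X≉0 p≉0 e e<m 1-Xqᵉ≈0 =
    poch-factor-≉0 _ m p≉0 l l<m (begin
      1# - (q * qneg q m) ÷ X * q ^ l                          ≈⟨ +-congˡ (-‿cong (trans (sym (*-identityʳ _)) (*-congˡ (sym Xqᵉ≈1)))) ⟩
      1# - (q * qneg q m) ÷ X * q ^ l * (X * q ^ e)            ≈⟨ +-congˡ (-‿cong (rearrange 6 (λ q p X′ x X y →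
                                                                     q ∙ p ∙ X′ ∙ x ∙ (X ∙ y) ≣ p ∙ (q ∙ (x ∙ y)) ∙ (X′ ∙ X))
                                                                   refl q (qneg q m) (X ⁻¹) (q ^ l) X (q ^ e))) ⟩
      1# - qneg q m * (q * (q ^ l * q ^ e)) * (X ⁻¹ * X)      ≈⟨ +-congˡ (-‿cong (*-cong (*-congˡ (*-congˡ (sym (^-+ q l e)))) (⁻¹-inverseˡ X≉0))) ⟩
      1# - qneg q m * q ^ suc (l ℕ.+ e) * 1#                  ≡⟨ ≡.cong (λ n → 1# - qneg q m * q ^ n * 1#) l+e+1≡m ⟩
      1# - qneg q m * q ^ m * 1#                              ≈⟨ +-congˡ (-‿cong (trans (*-identityʳ _) (qneg-inverse q≉0 m))) ⟩
      1# - 1#                                                 ≈⟨ -‿inverseʳ 1# ⟩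
      0#                                                      ∎)
    where
    l = m ∸ suc e
    l+e+1≡m : suc (l ℕ.+ e) ≡ m
    l+e+1≡m = ≡.trans (≡.sym (ℕ.+-suc l e)) (ℕ.m∸n+n≡m e<m)
    l<m : l < m
    l<m = ≡.subst (suc l ≤_) l+e+1≡m (s≤s (ℕ.m≤m+n l e))
    Xqᵉ≈1 : X * q ^ e ≈ 1#
    Xqᵉ≈1 = begin
      X * q ^ e              ≈⟨ solve 1 (λ a → a := 𝟙 :- (𝟙 :- a)) refl (X * q ^ e) ⟩
      1# - (1# - X * q ^ e)  ≈⟨ +-congˡ (-‿cong 1-Xqᵉ≈0) ⟩
      1# - 0#                ≈⟨ solve 0 (𝟙 :- con (+ 0) := 𝟙) refl ⟩
      1#                     ∎

  module TerminatingPhi21 (u v x : Carrier) (m : ℕ) (q≉0 : q ≉0) (u≉0 : u ≉0) (x≉0 : x ≉0)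
    (q-poch : ∀ j → j ≤ m → poch q q j ≉0)
    (b-poch : ∀ j → j ≤ m → poch q ((q * qneg q m) ÷ (u * x)) j ≉0) where

    private
      X = u * x
      z = (q * v) ÷ (u * u * x)
      t = v ÷ u
      b′ = (q * qneg q m) ÷ (u * x)
      X≉0 : X ≉0
      X≉0 = *-≉0 u≉0 x≉0

    step-identity : ∀ k n → suc (k ℕ.+ n) ≡ m →
      (1# - qneg q m * q ^ k) * z * (1# - X * q ^ n) ≈ t * (1# - b′ * q ^ k) * (1# - q * q ^ n)
    step-identity k n k+n+1≡m = begin
      (1# - qm * qᵏ) * z * (1# - X * qⁿ)
        ≈⟨ *-congʳ (*-congˡ (*-congˡ (trans (⁻¹-cong (*-≉0 (*-≉0 u≉0 u≉0) x≉0) (*-assoc u u x)) (⁻¹-distrib-* u≉0 X≉0)))) ⟩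
      (1# - qm * qᵏ) * (q * v * (u ⁻¹ * X ⁻¹)) * (1# - X * qⁿ)
        ≈⟨ solve 8 (λ qm qᵏ qⁿ q v u′ X′ X →
              (𝟙 :- qm :* qᵏ) :* (q :* v :* (u′ :* X′)) :* (𝟙 :- X :* qⁿ)
            := q :* v :* u′ :* X′ :- q :* v :* u′ :* X′ :* qm :* qᵏ :- q :* v :* u′ :* qⁿ :* (X′ :* X)
              :+ v :* u′ :* (qm :* (q :* (qᵏ :* qⁿ))) :* (X′ :* X))
            refl qm qᵏ qⁿ q v (u ⁻¹) (X ⁻¹) X ⟩
      q * v * u ⁻¹ * X ⁻¹ - q * v * u ⁻¹ * X ⁻¹ * qm * qᵏ - q * v * u ⁻¹ * qⁿ * (X ⁻¹ * X) + v * u ⁻¹ * ρ * (X ⁻¹ * X)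
        ≈⟨ +-cong (+-congˡ (-‿cong (*-congˡ (⁻¹-inverseˡ X≉0)))) (*-cong (*-congˡ ρ≈1) (⁻¹-inverseˡ X≉0)) ⟩
      q * v * u ⁻¹ * X ⁻¹ - q * v * u ⁻¹ * X ⁻¹ * qm * qᵏ - q * v * u ⁻¹ * qⁿ * 1# + v * u ⁻¹ * 1# * 1#
        ≈⟨ solve 7 (λ qm qᵏ qⁿ q v u′ X′ →
              q :* v :* u′ :* X′ :- q :* v :* u′ :* X′ :* qm :* qᵏ :- q :* v :* u′ :* qⁿ :* 𝟙 :+ v :* u′ :* 𝟙 :* 𝟙
            := v :* u′ :- q :* v :* u′ :* qⁿ :- q :* qm :* X′ :* qᵏ :* v :* u′ :+ q :* v :* u′ :* X′ :* 𝟙)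
            refl qm qᵏ qⁿ q v (u ⁻¹) (X ⁻¹) ⟩
      v * u ⁻¹ - q * v * u ⁻¹ * qⁿ - q * qm * X ⁻¹ * qᵏ * v * u ⁻¹ + q * v * u ⁻¹ * X ⁻¹ * 1#
        ≈⟨ +-congˡ (*-congˡ (sym ρ≈1)) ⟩
      v * u ⁻¹ - q * v * u ⁻¹ * qⁿ - q * qm * X ⁻¹ * qᵏ * v * u ⁻¹ + q * v * u ⁻¹ * X ⁻¹ * ρ
        ≈⟨ solve 7 (λ qm qᵏ qⁿ q v u′ X′ →
              v :* u′ :- q :* v :* u′ :* qⁿ :- q :* qm :* X′ :* qᵏ :* v :* u′ :+ q :* v :* u′ :* X′ :* (qm :* (q :* (qᵏ :* qⁿ)))
            := v :* u′ :* (𝟙 :- q :* qm :* X′ :* qᵏ) :* (𝟙 :- q :* qⁿ))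
            refl qm qᵏ qⁿ q v (u ⁻¹) (X ⁻¹) ⟩
      t * (1# - b′ * qᵏ) * (1# - q * qⁿ) ∎
      where
      qm = qneg q m
      qᵏ = q ^ k
      qⁿ = q ^ n
      ρ = qm * (q * (qᵏ * qⁿ))
      ρ≈1 : ρ ≈ 1#
      ρ≈1 = begin
        qm * (q * (qᵏ * qⁿ))    ≈⟨ *-congˡ (*-congˡ (^-+ q k n)) ⟨
        qm * q ^ suc (k ℕ.+ n)  ≡⟨ ≡.cong (λ e → qm * q ^ e) k+n+1≡m ⟩
        qm * q ^ m              ≈⟨ qneg-inverse q≉0 m ⟩
        1#                      ∎

    reversal-core : ∀ k n → n ℕ.+ k ≡ m →
      poch q (qneg q m) k * z ^ k * poch q q n * poch q (X * q ^ n) k ≈ t ^ k * poch q b′ k * poch q q m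
    reversal-core zero n n+0≡m = begin
      1# * 1# * poch q q n * 1#   ≡⟨ ≡.cong (λ e → 1# * 1# * poch q q e * 1#) (≡.trans (≡.sym (ℕ.+-identityʳ n)) n+0≡m) ⟩
      1# * 1# * poch q q m * 1#   ≈⟨ *-identityʳ _ ⟩
      1# * 1# * poch q q m        ∎
    reversal-core (suc k) n n+k+1≡m = *-cancelʳ l≉0 (begin
      P * (1# - qm * q ^ k) * (z * Z) * Q * poch q (X * q ^ n) (suc k) * l
        ≈⟨ *-congʳ (*-congˡ (trans (poch-sucˡ (X * q ^ n) k) (*-congˡ (poch-cong k (trans (*-assoc X (q ^ n) q) (*-congˡ (*-comm (q ^ n) q))))))) ⟩
      P * (1# - qm * q ^ k) * (z * Z) * Q * ((1# - X * q ^ n) * E) * l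
        ≈⟨ rearrange 8 (λ P a z Z Q b E l → P ∙ a ∙ (z ∙ Z) ∙ Q ∙ (b ∙ E) ∙ l ≣ (a ∙ z ∙ b) ∙ (P ∙ Z ∙ (Q ∙ l) ∙ E))
             refl P (1# - qm * q ^ k) z Z Q (1# - X * q ^ n) E l ⟩
      (1# - qm * q ^ k) * z * (1# - X * q ^ n) * (P * Z * (Q * l) * E)
        ≈⟨ *-cong (step-identity k n (≡.trans (≡.cong suc (ℕ.+-comm k n)) (≡.trans (≡.sym (ℕ.+-suc n k)) n+k+1≡m)))
                  (reversal-core k (suc n) (≡.trans (≡.sym (ℕ.+-suc n k)) n+k+1≡m)) ⟩
      t * (1# - b′ * q ^ k) * l * (t ^ k * poch q b′ k * poch q q m)
        ≈⟨ rearrange 6 (λ t b l T B Q → t ∙ b ∙ l ∙ (T ∙ B ∙ Q) ≣ t ∙ T ∙ (B ∙ b) ∙ Q ∙ l)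
             refl t (1# - b′ * q ^ k) l (t ^ k) (poch q b′ k) (poch q q m) ⟩
      t * t ^ k * (poch q b′ k * (1# - b′ * q ^ k)) * poch q q m * l ∎)
      where
      qm = qneg q m
      P = poch q qm k
      Z = z ^ k
      Q = poch q q n
      E = poch q (X * q ^ suc n) k
      l = 1# - q * q ^ n
      l≉0 : l ≉0
      l≉0 = poch-factor-≉0 q (suc n) (q-poch (suc n) (≡.subst (suc n ≤_) (≡.trans (≡.sym (ℕ.+-suc n k)) n+k+1≡m) (ℕ.m≤m+n (suc n) k))) n ℕ.≤-refl

    phi21-term : ∀ j → j ≤ m →
      (poch q u m ÷ poch q q m) * ((poch q (qneg q m) j * poch q X j * z ^ j) ÷ (poch q b′ j * poch q q j))
        ≈ poch q u m * t ^ j * (poch q X j ÷ (poch q q j * poch q q (m ∸ j) * poch q (X * q ^ (m ∸ j)) j))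
    phi21-term j j≤m = begin
      (U ÷ Qm) * ((P * PX * Z) ÷ (Pb * Qj))
        ≈⟨ ÷-*-÷ U (P * PX * Z) Qm≉0 (*-≉0 Pb≉0 Qj≉0) ⟩
      (U * (P * PX * Z)) ÷ (Qm * (Pb * Qj))
        ≈⟨ ÷-cross (*-≉0 Qm≉0 (*-≉0 Pb≉0 Qj≉0)) (*-≉0 (*-≉0 Qj≉0 Qn≉0) E≉0) (begin
             U * (P * PX * Z) * (Qj * Qn * E)
               ≈⟨ rearrange 7 (λ U P PX Z Qj Qn E → U ∙ (P ∙ PX ∙ Z) ∙ (Qj ∙ Qn ∙ E) ≣ U ∙ PX ∙ Qj ∙ (P ∙ Z ∙ Qn ∙ E))
                    refl U P PX Z Qj Qn E ⟩
             U * PX * Qj * (P * Z * Qn * E)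
               ≈⟨ *-congˡ (reversal-core j n (ℕ.m∸n+n≡m j≤m)) ⟩
             U * PX * Qj * (t ^ j * Pb * Qm)
               ≈⟨ rearrange 6 (λ U PX Qj T Pb Qm → U ∙ PX ∙ Qj ∙ (T ∙ Pb ∙ Qm) ≣ U ∙ T ∙ PX ∙ (Qm ∙ (Pb ∙ Qj)))
                    refl U PX Qj (t ^ j) Pb Qm ⟩
             U * t ^ j * PX * (Qm * (Pb * Qj)) ∎) ⟩
      (U * t ^ j * PX) ÷ (Qj * Qn * E)
        ≈⟨ *-assoc (U * t ^ j) PX _ ⟩
      U * t ^ j * (PX ÷ (Qj * Qn * E)) ∎
      where
      n = m ∸ j
      U = poch q u m
      Qm = poch q q m
      P = poch q (qneg q m) j
      PX = poch q X j
      Z = z ^ j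
      Pb = poch q b′ j
      Qj = poch q q j
      Qn = poch q q n
      E = poch q (X * q ^ n) j
      Qm≉0 = q-poch m ℕ.≤-refl
      Pb≉0 = b-poch j j≤m
      Qj≉0 = q-poch j j≤m
      Qn≉0 = q-poch n (ℕ.m∸n≤m m j)
      E≉0 : E ≉0
      E≉0 = regular-poch-≉0 n j (reversed-regular m q≉0 X≉0 (b-poch m ℕ.≤-refl)) (ℕ.≤-reflexive (ℕ.m∸n+n≡m j≤m)) refl

    phi21-reversal : (poch q u m ÷ poch q q m) * phi21 q (qneg q m) X b′ z m
      ≈ sumTo m (λ j → poch q u m * t ^ j * (poch q X j ÷ (poch q q j * poch q q (m ∸ j) * poch q (X * q ^ (m ∸ j)) j)))
    phi21-reversal = trans (sumTo-*ˡ _ _ m) (sumTo-cong m phi21-term)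

module WZPair {c ℓ : Level} (F : Field c ℓ) (q b w : Field.Carrier F) where

  open Field F
  open FieldOps F
  open FieldProperties F
  open Powers F
  open Pochhammer F q
  open FiniteSums F
  open import Relation.Binary.Reasoning.Setoid setoid
  open import Algebra.Properties.Ring ring using (-‿distribˡ-*)

  A : Carrier
  A = b * w

  numerator : ℕ → ℕ → ℕ → Carrier
  numerator i κ ν = b ^ i * poch q w i * poch q b κ

  -- Bases are products of powers of q, so that shifting an index is a ring identity.
  denominator : ℕ → ℕ → ℕ → Carrier
  denominator i κ ν = poch q q i * poch q q κ * poch q q ν * poch q (b * q ^ ν) κ
    * poch q (A * (q ^ i * q ^ κ * q ^ ν)) i * poch q (b * (q ^ κ * q ^ ν * q)) i

  summand : ℕ → ℕ → ℕ → Carrier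
  summand i κ ν = numerator i κ ν ÷ denominator i κ ν

  certificate : ℕ → ℕ → ℕ → Carrier
  certificate i κ ν = (- (q ^ κ * b * (1# - w * q ^ i) * (1# - q ^ ν)) * summand i κ ν) ÷ (1# - b * q ^ ν * q ^ κ)

  closedForm : ℕ → ℕ → Carrier
  closedForm n k = poch q A k ÷ (poch q q k * poch q q n * poch q (A * q ^ n) k)

  summand-sucκ₀ : ∀ κ ν → denominator 0 (suc κ) ν ≉0 → denominator 0 κ ν ≉0 →
    summand 0 (suc κ) ν * ((1# - q * q ^ κ) * (1# - b * q ^ ν * q ^ κ)) ≈ summand 0 κ ν * (1# - b * q ^ κ)
  summand-sucκ₀ κ ν d₁≉0 d₀≉0 = ÷-*-cross d₁≉0 d₀≉0
    (rearrange 7 (λ bκ cκ qκ l₁ qν Bκ l₂ →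
         ι ∙ ι ∙ (bκ ∙ cκ) ∙ (ι ∙ qκ ∙ qν ∙ Bκ ∙ ι ∙ ι) ∙ (l₁ ∙ l₂)
       ≣ ι ∙ ι ∙ bκ ∙ (ι ∙ (qκ ∙ l₁) ∙ qν ∙ (Bκ ∙ l₂) ∙ ι ∙ ι) ∙ cκ)
       refl (poch q b κ) (1# - b * q ^ κ) (poch q q κ) (1# - q * q ^ κ) (poch q q ν)
            (poch q (b * q ^ ν) κ) (1# - b * q ^ ν * q ^ κ))

  summand-sucκ : ∀ i κ ν → denominator i (suc κ) ν ≉0 → denominator i κ ν ≉0 →
    let X = A * (q ^ i * q ^ κ * q ^ ν)
        Y = b * (q ^ κ * q ^ ν * q)
    in summand i (suc κ) ν * ((1# - q * q ^ κ) * (1# - b * q ^ ν * q ^ κ) * (1# - X * q ^ i) * (1# - Y * q ^ i))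
       ≈ summand i κ ν * ((1# - b * q ^ κ) * (1# - X) * (1# - Y))
  summand-sucκ i κ ν d₁≉0 d₀≉0 = ÷-*-cross d₁≉0 d₀≉0 (begin
    bi * wi * (bκ * cκ) * (qi * qκ * qν * Bκ * poch q X i * poch q Y i) * (l₁ * l₂ * (1# - X * q ^ i) * (1# - Y * q ^ i))
      ≈⟨ rearrange 14 (λ bi wi bκ cκ qi qκ qν Bκ pX pY l₁ l₂ tX tY →
             bi ∙ wi ∙ (bκ ∙ cκ) ∙ (qi ∙ qκ ∙ qν ∙ Bκ ∙ pX ∙ pY) ∙ (l₁ ∙ l₂ ∙ tX ∙ tY)
           ≣ bi ∙ wi ∙ bκ ∙ cκ ∙ qi ∙ qκ ∙ qν ∙ Bκ ∙ l₁ ∙ l₂ ∙ (pX ∙ tX) ∙ (pY ∙ tY))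
           refl bi wi bκ cκ qi qκ qν Bκ (poch q X i) (poch q Y i) l₁ l₂ (1# - X * q ^ i) (1# - Y * q ^ i) ⟩
    bi * wi * bκ * cκ * qi * qκ * qν * Bκ * l₁ * l₂ * poch q X (suc i) * poch q Y (suc i)
      ≈⟨ *-cong (*-congˡ (trans (poch-sucˡ X i) (*-congˡ (poch-cong i X′≈)))) (trans (poch-sucˡ Y i) (*-congˡ (poch-cong i Y′≈))) ⟩
    bi * wi * bκ * cκ * qi * qκ * qν * Bκ * l₁ * l₂ * ((1# - X) * poch q X′ i) * ((1# - Y) * poch q Y′ i)
      ≈⟨ rearrange 14 (λ bi wi bκ cκ qi qκ qν Bκ pX pY l₁ l₂ tX tY →
             bi ∙ wi ∙ bκ ∙ cκ ∙ qi ∙ qκ ∙ qν ∙ Bκ ∙ l₁ ∙ l₂ ∙ (tX ∙ pX) ∙ (tY ∙ pY)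
           ≣ bi ∙ wi ∙ bκ ∙ (qi ∙ (qκ ∙ l₁) ∙ qν ∙ (Bκ ∙ l₂) ∙ pX ∙ pY) ∙ (cκ ∙ tX ∙ tY))
           refl bi wi bκ cκ qi qκ qν Bκ (poch q X′ i) (poch q Y′ i) l₁ l₂ (1# - X) (1# - Y) ⟩
    bi * wi * bκ * (qi * (qκ * l₁) * qν * (Bκ * l₂) * poch q X′ i * poch q Y′ i) * (cκ * (1# - X) * (1# - Y)) ∎)
    where
    X = A * (q ^ i * q ^ κ * q ^ ν)
    Y = b * (q ^ κ * q ^ ν * q)
    X′ = A * (q ^ i * q ^ suc κ * q ^ ν)
    Y′ = b * (q ^ suc κ * q ^ ν * q)
    bi = b ^ i
    wi = poch q w i
    bκ = poch q b κ
    cκ = 1# - b * q ^ κ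
    qi = poch q q i
    qκ = poch q q κ
    qν = poch q q ν
    Bκ = poch q (b * q ^ ν) κ
    l₁ = 1# - q * q ^ κ
    l₂ = 1# - b * q ^ ν * q ^ κ
    X′≈ : X * q ≈ X′
    X′≈ = rearrange 5 (λ A a k n q → A ∙ (a ∙ k ∙ n) ∙ q ≣ A ∙ (a ∙ (q ∙ k) ∙ n)) refl A (q ^ i) (q ^ κ) (q ^ ν) q
    Y′≈ : Y * q ≈ Y′
    Y′≈ = rearrange 4 (λ b k n q → b ∙ (k ∙ n ∙ q) ∙ q ≣ b ∙ (q ∙ k ∙ n ∙ q)) refl b (q ^ κ) (q ^ ν) q

  summand-suci : ∀ i κ ν → denominator (suc i) κ ν ≉0 → denominator i (suc κ) (suc ν) ≉0 →
    let X = A * (q ^ i * q ^ κ * q ^ ν)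
        Y = b * (q ^ κ * q ^ ν * q)
    in summand (suc i) κ ν * ((1# - b * q ^ κ) * (1# - b * q ^ ν) * (1# - q * q ^ i) * (1# - X * q) * (1# - Y * q))
       ≈ summand i (suc κ) (suc ν) * (b * (1# - w * q ^ i) * (1# - Y * q * q ^ i) * (1# - q * q ^ κ) * (1# - q * q ^ ν) * (1# - b * q ^ ν * q ^ κ))
  summand-suci i κ ν d₁≉0 d₂≉0 = ÷-*-cross d₁≉0 d₂≉0 (begin
    b * bi * (wi * tw) * bκ * (qi * (qκ * lqκ) * (qν * lqν) * poch q (b * q ^ suc ν) (suc κ) * poch q X₂ i * poch q Y₂ i) * M
      ≈⟨ *-congʳ (*-congˡ (*-cong (*-cong (*-congˡ (poch-cong (suc κ) B≈)) (poch-cong i X₂≈)) (poch-cong i Y₂≈))) ⟩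
    b * bi * (wi * tw) * bκ * (qi * (qκ * lqκ) * (qν * lqν) * (pBq * lBq) * pXqq * pYqq) * M
      ≈⟨ rearrange 19 (λ b bi wi tw bκ qi qκ lqκ qν lqν pBq lBq pXqq pYqq cκ lB lqi lXq lYq →
             b ∙ bi ∙ (wi ∙ tw) ∙ bκ ∙ (qi ∙ (qκ ∙ lqκ) ∙ (qν ∙ lqν) ∙ (pBq ∙ lBq) ∙ pXqq ∙ pYqq) ∙ (cκ ∙ lB ∙ lqi ∙ lXq ∙ lYq)
           ≣ (b ∙ bi ∙ wi ∙ tw ∙ bκ ∙ qi ∙ qκ ∙ lqκ ∙ qν ∙ lqν ∙ lBq ∙ pXqq ∙ cκ ∙ lqi ∙ lXq) ∙ (lB ∙ pBq) ∙ (lYq ∙ pYqq))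
           refl b bi wi tw bκ qi qκ lqκ qν lqν pBq lBq pXqq pYqq cκ (1# - Bν) lqi lXq lYq ⟩
    Rest * ((1# - Bν) * pBq) * ((1# - Y * q) * pYqq)
      ≈⟨ *-cong (*-congˡ (sym (poch-sucˡ Bν κ))) (sym (poch-sucˡ (Y * q) i)) ⟩
    Rest * (poch q Bν κ * (1# - Bν * q ^ κ)) * (poch q (Y * q) i * (1# - Y * q * q ^ i))
      ≈⟨ rearrange 19 (λ b bi wi tw bκ qi qκ lqκ qν lqν lBq pXqq cκ lqi lXq pB lBκ pYq lYqi →
             (b ∙ bi ∙ wi ∙ tw ∙ bκ ∙ qi ∙ qκ ∙ lqκ ∙ qν ∙ lqν ∙ lBq ∙ pXqq ∙ cκ ∙ lqi ∙ lXq) ∙ (pB ∙ lBκ) ∙ (pYq ∙ lYqi)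
           ≣ bi ∙ wi ∙ (bκ ∙ cκ) ∙ (qi ∙ lqi ∙ qκ ∙ qν ∙ pB ∙ (lXq ∙ pXqq) ∙ (lBq ∙ pYq)) ∙ (b ∙ tw ∙ lYqi ∙ lqκ ∙ lqν ∙ lBκ))
           refl b bi wi tw bκ qi qκ lqκ qν lqν lBq pXqq cκ lqi lXq (poch q Bν κ) (1# - Bν * q ^ κ) (poch q (Y * q) i) (1# - Y * q * q ^ i) ⟩
    bi * wi * (bκ * cκ) * (qi * lqi * qκ * qν * poch q Bν κ * (lXq * pXqq) * (lBq * poch q (Y * q) i)) * C
      ≈⟨ *-congʳ (*-congˡ (*-cong (*-congˡ (trans (sym (poch-sucˡ (X * q) i)) (poch-cong (suc i) X₁≈)))
                                   (trans (*-congʳ (+-congˡ (-‿cong Y≈))) (sym (poch-sucˡ Y i))))) ⟩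
    bi * wi * (bκ * cκ) * (qi * lqi * qκ * qν * poch q Bν κ * poch q X₁ (suc i) * poch q Y (suc i)) * C ∎)
    where
    X = A * (q ^ i * q ^ κ * q ^ ν)
    Y = b * (q ^ κ * q ^ ν * q)
    Bν = b * q ^ ν
    X₁ = A * (q ^ suc i * q ^ κ * q ^ ν)
    X₂ = A * (q ^ i * q ^ suc κ * q ^ suc ν)
    Y₂ = b * (q ^ suc κ * q ^ suc ν * q)
    bi = b ^ i
    wi = poch q w i
    tw = 1# - w * q ^ i
    bκ = poch q b κ
    cκ = 1# - b * q ^ κ
    qi = poch q q i
    qκ = poch q q κ
    lqκ = 1# - q * q ^ κ
    qν = poch q q ν
    lqν = 1# - q * q ^ ν
    lqi = 1# - q * q ^ i
    pBq = poch q (Bν * q) κ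
    lBq = 1# - Bν * q * q ^ κ
    pXqq = poch q (X * q * q) i
    pYqq = poch q (Y * q * q) i
    lXq = 1# - X * q
    lYq = 1# - Y * q
    M = cκ * (1# - Bν) * lqi * lXq * lYq
    C = b * tw * (1# - Y * q * q ^ i) * lqκ * lqν * (1# - Bν * q ^ κ)
    Rest = b * bi * wi * tw * bκ * qi * qκ * lqκ * qν * lqν * lBq * pXqq * cκ * lqi * lXq
    B≈ : b * q ^ suc ν ≈ Bν * q
    B≈ = rearrange 3 (λ b q n → b ∙ (q ∙ n) ≣ b ∙ n ∙ q) refl b q (q ^ ν)
    X₂≈ : X₂ ≈ X * q * q
    X₂≈ = rearrange 5 (λ A a k n q → A ∙ (a ∙ (q ∙ k) ∙ (q ∙ n)) ≣ A ∙ (a ∙ k ∙ n) ∙ q ∙ q) refl A (q ^ i) (q ^ κ) (q ^ ν) q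
    Y₂≈ : Y₂ ≈ Y * q * q
    Y₂≈ = rearrange 4 (λ b k n q → b ∙ (q ∙ k ∙ (q ∙ n) ∙ q) ≣ b ∙ (k ∙ n ∙ q) ∙ q ∙ q) refl b (q ^ κ) (q ^ ν) q
    X₁≈ : X * q ≈ X₁
    X₁≈ = rearrange 5 (λ A a k n q → A ∙ (a ∙ k ∙ n) ∙ q ≣ A ∙ (q ∙ a ∙ k ∙ n)) refl A (q ^ i) (q ^ κ) (q ^ ν) q
    Y≈ : Bν * q * q ^ κ ≈ Y
    Y≈ = rearrange 4 (λ b n q k → b ∙ n ∙ q ∙ k ≣ b ∙ (k ∙ n ∙ q)) refl b (q ^ ν) q (q ^ κ)

  summand-suci₀ : ∀ i ν → denominator (suc i) 0 ν ≉0 → denominator i 0 (suc ν) ≉0 →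
    let X = A * (q ^ i * 1# * q ^ ν)
        Y = b * (1# * q ^ ν * q)
    in summand (suc i) 0 ν * ((1# - q * q ^ i) * (1# - X * q * q ^ i) * (1# - Y))
       ≈ summand i 0 (suc ν) * (b * (1# - w * q ^ i) * (1# - q * q ^ ν))
  summand-suci₀ i ν d₁≉0 d₂≉0 = ÷-*-cross d₁≉0 d₂≉0 (begin
    b * bi * (wi * tw) * 1# * (qi * 1# * (qν * lqν) * 1# * poch q X₂ i * poch q Y₂ i) * (lqi * lXqi * lY)
      ≈⟨ *-congʳ (*-congˡ (*-cong (*-congˡ (poch-cong i X₂≈)) (poch-cong i Y₂≈))) ⟩
    b * bi * (wi * tw) * 1# * (qi * 1# * (qν * lqν) * 1# * poch q (X * q) i * poch q (Y * q) i) * (lqi * lXqi * lY)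
      ≈⟨ rearrange 12 (λ b bi wi tw qi qν lqν pX pY lqi lXqi lY →
             b ∙ bi ∙ (wi ∙ tw) ∙ ι ∙ (qi ∙ ι ∙ (qν ∙ lqν) ∙ ι ∙ pX ∙ pY) ∙ (lqi ∙ lXqi ∙ lY)
           ≣ bi ∙ wi ∙ ι ∙ (qi ∙ lqi ∙ ι ∙ qν ∙ ι ∙ (pX ∙ lXqi) ∙ (lY ∙ pY)) ∙ (b ∙ tw ∙ lqν))
           refl b bi wi tw qi qν lqν (poch q (X * q) i) (poch q (Y * q) i) lqi lXqi lY ⟩
    bi * wi * 1# * (qi * lqi * 1# * qν * 1# * poch q (X * q) (suc i) * ((1# - Y) * poch q (Y * q) i)) * (b * tw * lqν)
      ≈⟨ *-congʳ (*-congˡ (*-cong (*-congˡ (poch-cong (suc i) X₁≈)) (sym (poch-sucˡ Y i)))) ⟩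
    bi * wi * 1# * (qi * lqi * 1# * qν * 1# * poch q X₁ (suc i) * poch q Y (suc i)) * (b * tw * lqν) ∎)
    where
    X = A * (q ^ i * 1# * q ^ ν)
    Y = b * (1# * q ^ ν * q)
    X₁ = A * (q ^ suc i * 1# * q ^ ν)
    X₂ = A * (q ^ i * 1# * q ^ suc ν)
    Y₂ = b * (1# * q ^ suc ν * q)
    bi = b ^ i
    wi = poch q w i
    tw = 1# - w * q ^ i
    qi = poch q q i
    qν = poch q q ν
    lqν = 1# - q * q ^ ν
    lqi = 1# - q * q ^ i
    lXqi = 1# - X * q * q ^ i
    lY = 1# - Y
    X₂≈ : X₂ ≈ X * q
    X₂≈ = rearrange 4 (λ A a n q → A ∙ (a ∙ ι ∙ (q ∙ n)) ≣ A ∙ (a ∙ ι ∙ n) ∙ q) refl A (q ^ i) (q ^ ν) q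
    Y₂≈ : Y₂ ≈ Y * q
    Y₂≈ = rearrange 3 (λ b n q → b ∙ (ι ∙ (q ∙ n) ∙ q) ≣ b ∙ (ι ∙ n ∙ q) ∙ q) refl b (q ^ ν) q
    X₁≈ : X * q ≈ X₁
    X₁≈ = rearrange 4 (λ A a n q → A ∙ (a ∙ ι ∙ n) ∙ q ≣ A ∙ (q ∙ a ∙ ι ∙ n)) refl A (q ^ i) (q ^ ν) q

  wz-step-identity : ∀ Qs Qκ Qν →
    let Qi = q * Qs
        X  = A * (Qi * Qκ * Qν)
        Xs = A * (Qs * Qκ * Qν)
        Y  = b * (Qκ * Qν * q)
        Mκ′ = (1# - q * Qκ) * (1# - X * Qi) * (1# - Y * Qi)
        Mκ = (1# - q * Qκ) * (1# - b * Qν * Qκ) * (1# - X * Qi) * (1# - Y * Qi)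
        Mi′ = (1# - b * Qκ) * (1# - b * Qν) * (1# - q * Qs) * (1# - Xs * q)
        Ci = b * (1# - w * Qs) * (1# - Y * q * Qs) * (1# - q * Qκ) * (1# - q * Qν) * (1# - b * Qν * Qκ)
    in (1# - q * (Qi * Qκ)) * (1# - A * (Qi * Qν) * (Qi * Qκ)) * ((1# - b * Qκ) * (1# - X) * (1# - Y)) * Ci
       ≈ (1# - A * (Qi * Qκ)) * Ci * Mκ + - (Qκ * b * (1# - w * Qi) * (1# - Qν)) * Ci * Mκ′
         - - (q * Qκ * b * (1# - w * Qs) * (1# - q * Qν)) * Mi′ * Mκ
  wz-step-identity Qs Qκ Qν = solve 6 (λ q Qs Qκ Qν b w →
    let Qi = q :* Qs
        X  = b :* w :* (Qi :* Qκ :* Qν)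
        Xs = b :* w :* (Qs :* Qκ :* Qν)
        Y  = b :* (Qκ :* Qν :* q)
        Mκ′ = (𝟙 :- q :* Qκ) :* (𝟙 :- X :* Qi) :* (𝟙 :- Y :* Qi)
        Mκ = (𝟙 :- q :* Qκ) :* (𝟙 :- b :* Qν :* Qκ) :* (𝟙 :- X :* Qi) :* (𝟙 :- Y :* Qi)
        Mi′ = (𝟙 :- b :* Qκ) :* (𝟙 :- b :* Qν) :* (𝟙 :- q :* Qs) :* (𝟙 :- Xs :* q)
        Ci = b :* (𝟙 :- w :* Qs) :* (𝟙 :- Y :* q :* Qs) :* (𝟙 :- q :* Qκ) :* (𝟙 :- q :* Qν) :* (𝟙 :- b :* Qν :* Qκ)
    in (𝟙 :- q :* (Qi :* Qκ)) :* (𝟙 :- b :* w :* (Qi :* Qν) :* (Qi :* Qκ)) :* ((𝟙 :- b :* Qκ) :* (𝟙 :- X) :* (𝟙 :- Y)) :* Ci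
       := (𝟙 :- b :* w :* (Qi :* Qκ)) :* Ci :* Mκ :+ :- (Qκ :* b :* (𝟙 :- w :* Qi) :* (𝟙 :- Qν)) :* Ci :* Mκ′
          :- :- (q :* Qκ :* b :* (𝟙 :- w :* Qs) :* (𝟙 :- q :* Qν)) :* Mi′ :* Mκ)
    refl q Qs Qκ Qν b w

  module Regularity (R : ℕ) (q-reg : Regular q R) (b-reg : Regular b R) (A-reg : Regular A R) where

    private
      ≤-part : ∀ e d {N} → N ≤ R → e ℕ.+ d ≡ N → e ≤ R
      ≤-part e d N≤R eq = ℕ.≤-trans (≡.subst (e ≤_) eq (ℕ.m≤m+n e d)) N≤R

      q^-+₃ : ∀ a b c → q ^ (a ℕ.+ b ℕ.+ c) ≈ q ^ a * q ^ b * q ^ c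
      q^-+₃ a b c = trans (^-+ q (a ℕ.+ b) c) (*-congʳ (^-+ q a b))

      q^-+₄ : ∀ a b c d → q ^ (a ℕ.+ b ℕ.+ c ℕ.+ d) ≈ q ^ a * q ^ b * q ^ c * q ^ d
      q^-+₄ a b c d = trans (^-+ q (a ℕ.+ b ℕ.+ c) d) (*-congʳ (q^-+₃ a b c))

    qpoch-≉0 : ∀ n → n ≤ R → poch q q n ≉0
    qpoch-≉0 n n≤R = regular-poch-≉0 0 n q-reg n≤R (*-identityʳ q)

    denominator-≉0 : ∀ i κ ν → i ℕ.+ i ℕ.+ κ ℕ.+ ν ≤ R → denominator i κ ν ≉0
    denominator-≉0 i κ ν N≤R =
      *-≉0 (*-≉0 (*-≉0 (*-≉0 (*-≉0
        (qpoch-≉0 i (≤-part i (i ℕ.+ κ ℕ.+ ν) N≤R (ℕ-solve (i ∷ κ ∷ ν ∷ []))))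
        (qpoch-≉0 κ (≤-part κ (i ℕ.+ i ℕ.+ ν) N≤R (ℕ-solve (i ∷ κ ∷ ν ∷ [])))))
        (qpoch-≉0 ν (≤-part ν (i ℕ.+ i ℕ.+ κ) N≤R (ℕ-solve (i ∷ κ ∷ ν ∷ [])))))
        (regular-poch-≉0 ν κ b-reg (≤-part (ν ℕ.+ κ) (i ℕ.+ i) N≤R (ℕ-solve (i ∷ κ ∷ ν ∷ []))) refl))
        (regular-poch-≉0 (i ℕ.+ κ ℕ.+ ν) i A-reg (≤-part (i ℕ.+ κ ℕ.+ ν ℕ.+ i) 0 N≤R (ℕ-solve (i ∷ κ ∷ ν ∷ [])))
          (*-congˡ (q^-+₃ i κ ν))))
        (Y-part i N≤R)
      where
      Y-part : ∀ i → i ℕ.+ i ℕ.+ κ ℕ.+ ν ≤ R → poch q (b * (q ^ κ * q ^ ν * q)) i ≉0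
      Y-part zero    _   = λ 1≈0 → 0≉1 (sym 1≈0)
      Y-part (suc s) N≤R = regular-poch-≉0 (κ ℕ.+ ν ℕ.+ 1) (suc s) b-reg
        (≤-part (κ ℕ.+ ν ℕ.+ 1 ℕ.+ suc s) s N≤R (ℕ-solve (s ∷ κ ∷ ν ∷ [])))
        (*-congˡ (trans (^-+ q (κ ℕ.+ ν) 1) (*-cong (^-+ q κ ν) (*-identityʳ q))))

    wz-first : ∀ κ ν {Qk Qn} → suc (κ ℕ.+ ν) ≤ R → Qk ≈ q ^ 0 * q ^ κ → Qn ≈ q ^ 0 * q ^ ν →
      (1# - q * Qk) * (1# - A * Qn * Qk) * summand 0 (suc κ) ν
        ≈ (1# - A * Qk) * summand 0 κ ν + certificate 0 κ ν - 0#
    wz-first κ ν {Qk} {Qn} N<R Qk≈ Qn≈ = *-cancelʳ M≉0 (begin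
      (1# - q * Qk) * (1# - A * Qn * Qk) * β₁ * M
        ≈⟨ *-congʳ (*-congʳ (*-cong (+-congˡ (-‿cong (*-congˡ Qk≈))) (+-congˡ (-‿cong (*-cong (*-congˡ Qn≈) Qk≈))))) ⟩
      (1# - q * (1# * Qκ)) * (1# - A * (1# * Qν) * (1# * Qκ)) * β₁ * M
        ≈⟨ *-assoc _ β₁ M ⟩
      (1# - q * (1# * Qκ)) * (1# - A * (1# * Qν) * (1# * Qκ)) * (β₁ * M)
        ≈⟨ *-congˡ (summand-sucκ₀ κ ν (denominator-≉0 0 (suc κ) ν N<R) (denominator-≉0 0 κ ν (ℕ.<⇒≤ N<R))) ⟩
      (1# - q * (1# * Qκ)) * (1# - A * (1# * Qν) * (1# * Qκ)) * (β₀ * (1# - b * Qκ))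
        ≈⟨ solve 6 (λ q Qκ Qν b w β₀ →
              (𝟙 :- q :* (𝟙 :* Qκ)) :* (𝟙 :- b :* w :* (𝟙 :* Qν) :* (𝟙 :* Qκ)) :* (β₀ :* (𝟙 :- b :* Qκ))
            := (𝟙 :- b :* w :* (𝟙 :* Qκ)) :* β₀ :* ((𝟙 :- q :* Qκ) :* (𝟙 :- b :* Qν :* Qκ))
              :+ (:- (Qκ :* b :* (𝟙 :- w :* 𝟙) :* (𝟙 :- Qν)) :* β₀) :* (𝟙 :- q :* Qκ))
            refl q Qκ Qν b w β₀ ⟩
      (1# - A * (1# * Qκ)) * β₀ * M + (g * β₀) * (1# - q * Qκ)
        ≈⟨ +-congˡ (*-congʳ (sym (÷-*-cancel (g * β₀) L≉0))) ⟩
      (1# - A * (1# * Qκ)) * β₀ * M + G * L * (1# - q * Qκ)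
        ≈⟨ solve 5 (λ c β₀ G lq L → c :* β₀ :* (lq :* L) :+ G :* L :* lq := (c :* β₀ :+ G :- con (+ 0)) :* (lq :* L))
             refl (1# - A * (1# * Qκ)) β₀ G (1# - q * Qκ) L ⟩
      ((1# - A * (1# * Qκ)) * β₀ + G - 0#) * M
        ≈⟨ *-congʳ (+-congʳ (+-congʳ (*-congʳ (+-congˡ (-‿cong (*-congˡ (sym Qk≈))))))) ⟩
      ((1# - A * Qk) * β₀ + G - 0#) * M ∎)
      where
      Qκ = q ^ κ
      Qν = q ^ ν
      β₀ = summand 0 κ ν
      β₁ = summand 0 (suc κ) ν
      G = certificate 0 κ ν
      g = - (Qκ * b * (1# - w * 1#) * (1# - Qν))
      L = 1# - b * Qν * Qκ
      M = (1# - q * Qκ) * L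
      L≉0 : L ≉0
      L≉0 = regular-factor-≉0 (ν ℕ.+ κ) b-reg (≤-part (suc (ν ℕ.+ κ)) 0 N<R (ℕ-solve (κ ∷ ν ∷ [])))
              (trans (*-congˡ (^-+ q ν κ)) (sym (*-assoc b Qν Qκ)))
      M≉0 : M ≉0
      M≉0 = *-≉0 (regular-factor-≉0 κ q-reg (≤-part (suc κ) ν N<R ≡.refl) refl) L≉0

    wz-step : ∀ s κ ν {Qk Qn} → suc (suc s ℕ.+ suc s ℕ.+ κ ℕ.+ ν) ≤ R →
      Qk ≈ q ^ suc s * q ^ κ → Qn ≈ q ^ suc s * q ^ ν →
      (1# - q * Qk) * (1# - A * Qn * Qk) * summand (suc s) (suc κ) ν
        ≈ (1# - A * Qk) * summand (suc s) κ ν + certificate (suc s) κ ν - certificate s (suc κ) (suc ν)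
    wz-step s κ ν {Qk} {Qn} N<R Qk≈ Qn≈ = *-cancelʳ D≉0 (begin
      (1# - q * Qk) * (1# - A * Qn * Qk) * β₁ * (Mi * Mκ)
        ≈⟨ *-congʳ (*-congʳ (*-cong (+-congˡ (-‿cong (*-congˡ Qk≈))) (+-congˡ (-‿cong (*-cong (*-congˡ Qn≈) Qk≈))))) ⟩
      cf * β₁ * (Mi * Mκ)
        ≈⟨ solve 4 (λ cf β₁ Mi Mκ → cf :* β₁ :* (Mi :* Mκ) := cf :* (β₁ :* Mκ) :* Mi) refl cf β₁ Mi Mκ ⟩
      cf * (β₁ * Mκ) * Mi
        ≈⟨ *-congʳ (*-congˡ (summand-sucκ (suc s) κ ν d₁≉0 d₀≉0)) ⟩
      cf * (β₀ * Cκ) * Mi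
        ≈⟨ solve 4 (λ cf β₀ Cκ Mi → cf :* (β₀ :* Cκ) :* Mi := cf :* Cκ :* (β₀ :* Mi)) refl cf β₀ Cκ Mi ⟩
      cf * Cκ * (β₀ * Mi)
        ≈⟨ *-congˡ (summand-suci s κ ν d₀≉0 d₋≉0) ⟩
      cf * Cκ * (β₋ * Ci)
        ≈⟨ solve 4 (λ cf Cκ β Ci → cf :* Cκ :* (β :* Ci) := β :* (cf :* Cκ :* Ci)) refl cf Cκ β₋ Ci ⟩
      β₋ * (cf * Cκ * Ci)
        ≈⟨ *-congˡ (wz-step-identity Qs Qκ Qν) ⟩
      β₋ * (c₀ * Ci * Mκ + g₂ * Ci * Mκ′ - g₃ * Mi′ * Mκ)
        ≈⟨ solve 8 (λ β c₀ Ci Mκ g₂ Mκ′ g₃ Mi′ →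
              β :* (c₀ :* Ci :* Mκ :+ g₂ :* Ci :* Mκ′ :- g₃ :* Mi′ :* Mκ)
            := c₀ :* (β :* Ci) :* Mκ :+ g₂ :* (β :* Ci) :* Mκ′ :- g₃ :* β :* Mi′ :* Mκ)
            refl β₋ c₀ Ci Mκ g₂ Mκ′ g₃ Mi′ ⟩
      c₀ * (β₋ * Ci) * Mκ + g₂ * (β₋ * Ci) * Mκ′ - g₃ * β₋ * Mi′ * Mκ
        ≈⟨ +-cong (+-cong (*-congʳ (*-congˡ β₀Mi≈)) (*-congʳ (*-congˡ β₀Mi≈))) (-‿cong (*-congʳ (*-congʳ G₃≈))) ⟩
      c₀ * (β₀ * Mi) * Mκ + g₂ * (β₀ * Mi) * Mκ′ - G₃ * L₂ * Mi′ * Mκ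
        ≈⟨ +-cong (+-congˡ (trans (solve 4 (λ g β₀ Mi M → g :* (β₀ :* Mi) :* M := g :* β₀ :* Mi :* M) refl g₂ β₀ Mi Mκ′)
                                    (*-congʳ (*-congʳ G₂≈))))
                  (-‿cong (*-congʳ (*-congʳ (*-congˡ L₂≈)))) ⟩
      c₀ * (β₀ * Mi) * Mκ + G₂ * L₁ * Mi * Mκ′ - G₃ * (1# - Y * q) * Mi′ * Mκ
        ≈⟨ solve 10 (λ c₀ β₀ G₂ G₃ Mi′ lYq lqκ L₁ lX lY →
              let Mi = Mi′ :* lYq
                  Mκ′ = lqκ :* lX :* lY
                  Mκ = lqκ :* L₁ :* lX :* lY
              in c₀ :* (β₀ :* Mi) :* Mκ :+ G₂ :* L₁ :* Mi :* Mκ′ :- G₃ :* lYq :* Mi′ :* Mκ := (c₀ :* β₀ :+ G₂ :- G₃) :* (Mi :* Mκ))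
            refl c₀ β₀ G₂ G₃ Mi′ (1# - Y * q) (1# - q * Qκ) L₁ (1# - X * Qi) (1# - Y * Qi) ⟩
      (c₀ * β₀ + G₂ - G₃) * (Mi * Mκ)
        ≈⟨ *-congʳ (+-congʳ (+-congʳ (*-congʳ (+-congˡ (-‿cong (*-congˡ (sym Qk≈))))))) ⟩
      ((1# - A * Qk) * β₀ + G₂ - G₃) * (Mi * Mκ) ∎)
      where
      i = suc s
      Qs = q ^ s
      Qi = q ^ i
      Qκ = q ^ κ
      Qν = q ^ ν
      X = A * (Qi * Qκ * Qν)
      Xs = A * (Qs * Qκ * Qν)
      Y = b * (Qκ * Qν * q)
      β₁ = summand i (suc κ) ν
      β₀ = summand i κ ν
      β₋ = summand s (suc κ) (suc ν)
      G₂ = certificate i κ ν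
      G₃ = certificate s (suc κ) (suc ν)
      cf = (1# - q * (Qi * Qκ)) * (1# - A * (Qi * Qν) * (Qi * Qκ))
      c₀ = 1# - A * (Qi * Qκ)
      Cκ = (1# - b * Qκ) * (1# - X) * (1# - Y)
      Mκ = (1# - q * Qκ) * (1# - b * Qν * Qκ) * (1# - X * Qi) * (1# - Y * Qi)
      Mκ′ = (1# - q * Qκ) * (1# - X * Qi) * (1# - Y * Qi)
      Ci = b * (1# - w * Qs) * (1# - Y * q * Qs) * (1# - q * Qκ) * (1# - q * Qν) * (1# - b * Qν * Qκ)
      Mi = (1# - b * Qκ) * (1# - b * Qν) * (1# - q * Qs) * (1# - Xs * q) * (1# - Y * q)
      Mi′ = (1# - b * Qκ) * (1# - b * Qν) * (1# - q * Qs) * (1# - Xs * q)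
      g₂ = - (Qκ * b * (1# - w * Qi) * (1# - Qν))
      g₃ = - (q * Qκ * b * (1# - w * Qs) * (1# - q * Qν))
      L₁ = 1# - b * Qν * Qκ
      L₂ = 1# - b * q ^ suc ν * q ^ suc κ
      L₂≈ : L₂ ≈ 1# - Y * q
      L₂≈ = +-congˡ (-‿cong (solve 4 (λ b q Qν Qκ → b :* (q :* Qν) :* (q :* Qκ) := b :* (Qκ :* Qν :* q) :* q) refl b q Qν Qκ))
      d₁≉0 : denominator i (suc κ) ν ≉0
      d₁≉0 = denominator-≉0 i (suc κ) ν (≤-part (suc s ℕ.+ suc s ℕ.+ suc κ ℕ.+ ν) 0 N<R (ℕ-solve (s ∷ κ ∷ ν ∷ [])))
      d₀≉0 : denominator i κ ν ≉0
      d₀≉0 = denominator-≉0 i κ ν (≤-part (suc s ℕ.+ suc s ℕ.+ κ ℕ.+ ν) 1 N<R (ℕ-solve (s ∷ κ ∷ ν ∷ [])))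
      d₋≉0 : denominator s (suc κ) (suc ν) ≉0
      d₋≉0 = denominator-≉0 s (suc κ) (suc ν) (≤-part (s ℕ.+ s ℕ.+ suc κ ℕ.+ suc ν) 1 N<R (ℕ-solve (s ∷ κ ∷ ν ∷ [])))
      factor≉0 : ∀ {x y} → Regular x R → ∀ e d → e ℕ.+ d ≡ suc s ℕ.+ suc s ℕ.+ κ ℕ.+ ν → x * q ^ e ≈ y → 1# - y ≉0
      factor≉0 reg e d eq x≈y = regular-factor-≉0 e reg (≤-part (suc e) d N<R (≡.cong suc eq)) x≈y
      L₁≉0 : L₁ ≉0
      L₁≉0 = factor≉0 b-reg (ν ℕ.+ κ) (suc s ℕ.+ suc s) (ℕ-solve (s ∷ κ ∷ ν ∷ []))
               (trans (*-congˡ (^-+ q ν κ)) (sym (*-assoc b Qν Qκ)))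
      L₂≉0 : L₂ ≉0
      L₂≉0 = factor≉0 b-reg (suc ν ℕ.+ suc κ) (s ℕ.+ s) (ℕ-solve (s ∷ κ ∷ ν ∷ []))
               (trans (*-congˡ (^-+ q (suc ν) (suc κ))) (sym (*-assoc b _ _)))
      D≉0 : Mi * Mκ ≉0
      D≉0 = *-≉0
        (*-≉0 (*-≉0 (*-≉0 (*-≉0
          (factor≉0 b-reg κ (suc s ℕ.+ suc s ℕ.+ ν) (ℕ-solve (s ∷ κ ∷ ν ∷ [])) refl)
          (factor≉0 b-reg ν (suc s ℕ.+ suc s ℕ.+ κ) (ℕ-solve (s ∷ κ ∷ ν ∷ [])) refl))
          (factor≉0 q-reg s (suc (suc s) ℕ.+ κ ℕ.+ ν) (ℕ-solve (s ∷ κ ∷ ν ∷ [])) refl))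
          (factor≉0 A-reg (s ℕ.+ κ ℕ.+ ν ℕ.+ 1) (suc s) (ℕ-solve (s ∷ κ ∷ ν ∷ []))
            (trans (*-congˡ (q^-+₄ s κ ν 1))
                   (solve 5 (λ A Qs Qκ Qν q → A :* (Qs :* Qκ :* Qν :* (q :* 𝟙)) := A :* (Qs :* Qκ :* Qν) :* q) refl A Qs Qκ Qν q))))
          (≉0-resp L₂≈ L₂≉0))
        (*-≉0 (*-≉0 (*-≉0
          (factor≉0 q-reg κ (suc s ℕ.+ suc s ℕ.+ ν) (ℕ-solve (s ∷ κ ∷ ν ∷ [])) refl)
          L₁≉0)
          (factor≉0 A-reg (suc s ℕ.+ κ ℕ.+ ν ℕ.+ suc s) 0 (ℕ-solve (s ∷ κ ∷ ν ∷ []))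
            (trans (*-congˡ (q^-+₄ i κ ν i))
                   (solve 5 (λ A Qi Qκ Qν q → A :* (Qi :* Qκ :* Qν :* Qi) := A :* (Qi :* Qκ :* Qν) :* Qi) refl A Qi Qκ Qν q))))
          (factor≉0 b-reg (κ ℕ.+ ν ℕ.+ 1 ℕ.+ suc s) s (ℕ-solve (s ∷ κ ∷ ν ∷ []))
            (trans (*-congˡ (q^-+₄ κ ν 1 i))
                   (solve 5 (λ b Qi Qκ Qν q → b :* (Qκ :* Qν :* (q :* 𝟙) :* Qi) := b :* (Qκ :* Qν :* q) :* Qi) refl b Qi Qκ Qν q))))
      β₀Mi≈ : β₋ * Ci ≈ β₀ * Mi
      β₀Mi≈ = sym (summand-suci s κ ν d₀≉0 d₋≉0)
      G₂≈ : g₂ * β₀ ≈ G₂ * L₁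
      G₂≈ = sym (÷-*-cancel (g₂ * β₀) L₁≉0)
      G₃≈ : g₃ * β₋ ≈ G₃ * L₂
      G₃≈ = sym (÷-*-cancel (g₃ * β₋) L₂≉0)

    wz-last : ∀ k ν {Qk Qn} → suc k ℕ.+ suc k ℕ.+ 0 ℕ.+ ν ≤ R → Qk ≈ q ^ k → Qn ≈ q ^ k * q ^ suc ν →
      (1# - q * Qk) * (1# - A * Qn * Qk) * summand (suc k) 0 ν ≈ - certificate k 0 (suc ν)
    wz-last k ν {Qk} {Qn} N≤R Qk≈ Qn≈ = *-cancelʳ L≉0 (begin
      (1# - q * Qk) * (1# - A * Qn * Qk) * β₁ * L
        ≈⟨ *-congʳ (*-congʳ (*-cong (+-congˡ (-‿cong (*-congˡ Qk≈))) (+-congˡ (-‿cong (*-cong (*-congˡ Qn≈) Qk≈))))) ⟩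
      (1# - q * Qκ) * (1# - A * (Qκ * (q * Qν)) * Qκ) * β₁ * L
        ≈⟨ solve 6 (λ q Qκ Qν b w β₁ →
              (𝟙 :- q :* Qκ) :* (𝟙 :- b :* w :* (Qκ :* (q :* Qν)) :* Qκ) :* β₁ :* (𝟙 :- b :* (q :* Qν) :* 𝟙)
            := β₁ :* ((𝟙 :- q :* Qκ) :* (𝟙 :- b :* w :* (Qκ :* 𝟙 :* Qν) :* q :* Qκ) :* (𝟙 :- b :* (𝟙 :* Qν :* q))))
            refl q Qκ Qν b w β₁ ⟩
      β₁ * ((1# - q * Qκ) * (1# - X * q * Qκ) * (1# - Y))
        ≈⟨ summand-suci₀ k ν (denominator-≉0 (suc k) 0 ν N≤R)
             (denominator-≉0 k 0 (suc ν) (≤-part (k ℕ.+ k ℕ.+ 0 ℕ.+ suc ν) 1 N≤R (ℕ-solve (k ∷ ν ∷ [])))) ⟩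
      β₀ * (b * (1# - w * Qκ) * (1# - q * Qν))
        ≈⟨ solve 6 (λ q Qκ Qν b w β₀ →
              β₀ :* (b :* (𝟙 :- w :* Qκ) :* (𝟙 :- q :* Qν)) := :- (:- (𝟙 :* b :* (𝟙 :- w :* Qκ) :* (𝟙 :- q :* Qν)) :* β₀))
            refl q Qκ Qν b w β₀ ⟩
      - (g * β₀)
        ≈⟨ -‿cong (÷-*-cancel (g * β₀) L≉0) ⟨
      - (G * L)
        ≈⟨ -‿distribˡ-* G L ⟩
      - G * L ∎)
      where
      Qκ = q ^ k
      Qν = q ^ ν
      X = A * (Qκ * 1# * Qν)
      Y = b * (1# * Qν * q)
      β₁ = summand (suc k) 0 ν
      β₀ = summand k 0 (suc ν)
      G = certificate k 0 (suc ν)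
      g = - (1# * b * (1# - w * Qκ) * (1# - q * Qν))
      L = 1# - b * q ^ suc ν * 1#
      L≉0 : L ≉0
      L≉0 = regular-factor-≉0 (suc ν) b-reg (≤-part (suc (suc ν)) (k ℕ.+ k) N≤R (ℕ-solve (k ∷ ν ∷ [])))
              (sym (*-identityʳ _))

    closedForm-denominator-≉0 : ∀ n k → n ℕ.+ k ≤ R → poch q q k * poch q q n * poch q (A * q ^ n) k ≉0
    closedForm-denominator-≉0 n k n+k≤R =
      *-≉0 (*-≉0 (qpoch-≉0 k (ℕ.≤-trans (ℕ.m≤n+m k n) n+k≤R)) (qpoch-≉0 n (ℕ.≤-trans (ℕ.m≤m+n n k) n+k≤R)))
           (regular-poch-≉0 n k A-reg n+k≤R refl)

    closedForm-suc : ∀ n k → n ℕ.+ suc k ≤ R →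
      closedForm n (suc k) * ((1# - q * q ^ k) * (1# - A * q ^ n * q ^ k)) ≈ closedForm n k * (1# - A * q ^ k)
    closedForm-suc n k bound = ÷-*-cross
      (closedForm-denominator-≉0 n (suc k) bound)
      (closedForm-denominator-≉0 n k (ℕ.≤-trans (ℕ.+-monoʳ-≤ n (ℕ.n≤1+n k)) bound))
      (rearrange 7 (λ Ak lA qk lq qn An lAn →
          (Ak ∙ lA) ∙ (qk ∙ qn ∙ An) ∙ (lq ∙ lAn) ≣ Ak ∙ (qk ∙ lq ∙ qn ∙ (An ∙ lAn)) ∙ lA)
        refl (poch q A k) (1# - A * q ^ k) (poch q q k) (1# - q * q ^ k) (poch q q n)
             (poch q (A * q ^ n) k) (1# - A * q ^ n * q ^ k))

    closedForm-symmetric : ∀ n k → n ℕ.+ k ≤ R → closedForm n k ≈ closedForm k n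
    closedForm-symmetric n k n+k≤R = ÷-cross
      (closedForm-denominator-≉0 n k n+k≤R)
      (closedForm-denominator-≉0 k n (≡.subst (_≤ R) (ℕ.+-comm n k) n+k≤R)) (begin
        poch q A k * (poch q q n * poch q q k * poch q (A * q ^ k) n)
          ≈⟨ rearrange 4 (λ a b c d → a ∙ (b ∙ c ∙ d) ≣ a ∙ d ∙ (b ∙ c)) refl _ _ _ _ ⟩
        poch q A k * poch q (A * q ^ k) n * (poch q q n * poch q q k)
          ≈⟨ *-cong (poch-+-comm A k n) (*-comm _ _) ⟩
        poch q A n * poch q (A * q ^ n) k * (poch q q k * poch q q n)
          ≈⟨ rearrange 4 (λ a d b c → a ∙ d ∙ (b ∙ c) ≣ a ∙ (b ∙ c ∙ d)) refl _ _ _ _ ⟩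
        poch q A n * (poch q q k * poch q q n * poch q (A * q ^ n) k) ∎)

    summand-symmetric : ∀ i κ ν → i ℕ.+ i ℕ.+ κ ℕ.+ ν ≤ R → summand i κ ν ≈ summand i ν κ
    summand-symmetric i κ ν bound = ÷-cross
      (denominator-≉0 i κ ν bound)
      (denominator-≉0 i ν κ (≡.subst (_≤ R) swap bound)) (begin
        bi * wi * bκ * (qi * qν * qκ * poch q (b * q ^ κ) ν * poch q X′ i * poch q Y′ i)
          ≈⟨ *-congˡ (*-cong (*-congˡ (poch-cong i X′≈)) (poch-cong i Y′≈)) ⟩
        bi * wi * bκ * (qi * qν * qκ * poch q (b * q ^ κ) ν * poch q X i * poch q Y i)
          ≈⟨ rearrange 9 (λ bi wi bκ qi qν qκ Bν X Y →
                bi ∙ wi ∙ bκ ∙ (qi ∙ qν ∙ qκ ∙ Bν ∙ X ∙ Y) ≣ bi ∙ wi ∙ (bκ ∙ Bν) ∙ (qi ∙ qκ ∙ qν ∙ X ∙ Y))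
              refl bi wi bκ qi qν qκ (poch q (b * q ^ κ) ν) (poch q X i) (poch q Y i) ⟩
        bi * wi * (bκ * poch q (b * q ^ κ) ν) * (qi * qκ * qν * poch q X i * poch q Y i)
          ≈⟨ *-congʳ (*-congˡ (poch-+-comm b κ ν)) ⟩
        bi * wi * (bν * poch q (b * q ^ ν) κ) * (qi * qκ * qν * poch q X i * poch q Y i)
          ≈⟨ rearrange 9 (λ bi wi bν qi qν qκ Bκ X Y →
                bi ∙ wi ∙ (bν ∙ Bκ) ∙ (qi ∙ qκ ∙ qν ∙ X ∙ Y) ≣ bi ∙ wi ∙ bν ∙ (qi ∙ qκ ∙ qν ∙ Bκ ∙ X ∙ Y))
              refl bi wi bν qi qν qκ (poch q (b * q ^ ν) κ) (poch q X i) (poch q Y i) ⟩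
        bi * wi * bν * (qi * qκ * qν * poch q (b * q ^ ν) κ * poch q X i * poch q Y i) ∎)
      where
      swap : i ℕ.+ i ℕ.+ κ ℕ.+ ν ≡ i ℕ.+ i ℕ.+ ν ℕ.+ κ
      swap = ℕ-solve (i ∷ κ ∷ ν ∷ [])
      bi = b ^ i
      wi = poch q w i
      bκ = poch q b κ
      bν = poch q b ν
      qi = poch q q i
      qκ = poch q q κ
      qν = poch q q ν
      X = A * (q ^ i * q ^ κ * q ^ ν)
      Y = b * (q ^ κ * q ^ ν * q)
      X′ = A * (q ^ i * q ^ ν * q ^ κ)
      Y′ = b * (q ^ ν * q ^ κ * q)
      X′≈ : X′ ≈ X
      X′≈ = *-congˡ (trans (*-assoc _ _ _) (trans (*-congˡ (*-comm _ _)) (sym (*-assoc _ _ _))))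
      Y′≈ : Y′ ≈ Y
      Y′≈ = *-congˡ (*-congʳ (*-comm _ _))

    private
      level-first : ∀ n k → n ℕ.+ suc k ≡ suc (k ℕ.+ n)
      level-first n k = ℕ-solve (n ∷ k ∷ [])

      level-step : ∀ s κ ν → suc s ℕ.+ ν ℕ.+ suc (suc s ℕ.+ κ) ≡ suc (suc s ℕ.+ suc s ℕ.+ κ ℕ.+ ν)
      level-step s κ ν = ℕ-solve (s ∷ κ ∷ ν ∷ [])

      level-last : ∀ k ν → k ℕ.+ suc ν ℕ.+ suc k ≡ suc k ℕ.+ suc k ℕ.+ 0 ℕ.+ ν
      level-last k ν = ℕ-solve (k ∷ ν ∷ [])

    summand-sum-≤ : ∀ n k → k ≤ n → n ℕ.+ k ≤ R → sumTo k (λ i → summand i (k ∸ i) (n ∸ i)) ≈ closedForm n k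
    summand-sum-≤ n zero _ bound = ÷-cong
      (denominator-≉0 0 0 n (ℕ.≤-trans (ℕ.m≤m+n n 0) bound))
      (rearrange 0 (ι ∙ ι ∙ ι ≣ ι) refl)
      (rearrange 1 (λ qn → ι ∙ ι ∙ qn ∙ ι ∙ ι ∙ ι ≣ ι ∙ qn ∙ ι) refl (poch q q n))
    summand-sum-≤ n (suc k) k<n bound = *-cancelˡ cf≉0 (begin
      cf * sumTo (suc k) (λ i → summand i (suc k ∸ i) (n ∸ i))  ≈⟨ sumTo-*ˡ cf _ (suc k) ⟩
      sumTo (suc k) X                                           ≈⟨ sumTo-telescope k X Y C d refl step last ⟩
      d * sumTo k Y                                             ≈⟨ *-congˡ (summand-sum-≤ n k (ℕ.<⇒≤ k<n) bound′) ⟩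
      d * closedForm n k                                        ≈⟨ *-comm d _ ⟩
      closedForm n k * d                                        ≈⟨ closedForm-suc n k bound ⟨
      closedForm n (suc k) * cf                                 ≈⟨ *-comm _ cf ⟩
      cf * closedForm n (suc k)                                 ∎)
      where
      cf = (1# - q * q ^ k) * (1# - A * q ^ n * q ^ k)
      d = 1# - A * q ^ k
      X : ℕ → Carrier
      X i = cf * summand i (suc k ∸ i) (n ∸ i)
      Y : ℕ → Carrier
      Y i = summand i (k ∸ i) (n ∸ i)
      C : ℕ → Carrier
      C zero    = 0#
      C (suc i) = certificate i (k ∸ i) (n ∸ i)
      bound′ : n ℕ.+ k ≤ R
      bound′ = ℕ.≤-trans (ℕ.+-monoʳ-≤ n (ℕ.n≤1+n k)) bound
      cf≉0 : cf ≉0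
      cf≉0 = *-≉0 (regular-factor-≉0 k q-reg (ℕ.≤-trans (ℕ.m≤n+m (suc k) n) bound) refl)
                  (regular-factor-≉0 (n ℕ.+ k) A-reg (≡.subst (_≤ R) (ℕ.+-suc n k) bound)
                    (trans (*-congˡ (^-+ q n k)) (sym (*-assoc A _ _))))
      step : ∀ i → i ≤ k → X i ≈ d * Y i + C (suc i) - C i
      step zero    _   = wz-first k n (≡.subst (_≤ R) (level-first n k) bound)
                           (sym (*-identityˡ _)) (sym (*-identityˡ _))
      step (suc s) s<k = begin
        cf * summand (suc s) (k ∸ s) ν
          ≡⟨ ≡.cong (λ m → cf * summand (suc s) m ν) k∸s ⟩
        cf * summand (suc s) (suc κ) ν
          ≈⟨ wz-step s κ ν (≡.subst (_≤ R) (≡.trans (≡.cong₂ (λ a c → a ℕ.+ suc c) n≡ k≡) (level-step s κ ν)) bound)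
               (trans (reflexive (≡.cong (q ^_) k≡)) (^-+ q (suc s) κ))
               (trans (reflexive (≡.cong (q ^_) n≡)) (^-+ q (suc s) ν)) ⟩
        d * summand (suc s) κ ν + certificate (suc s) κ ν - certificate s (suc κ) (suc ν)
          ≡⟨ ≡.cong₂ (λ a c → d * summand (suc s) κ ν + certificate (suc s) κ ν - certificate s a c) k∸s n∸s ⟨
        d * Y (suc s) + C (suc (suc s)) - C (suc s) ∎
        where
        κ = k ∸ suc s
        ν = n ∸ suc s
        s<n : s < n
        s<n = ℕ.≤-trans s<k (ℕ.<⇒≤ k<n)
        k∸s : k ∸ s ≡ suc κ
        k∸s = ℕ.+-∸-assoc 1 s<k
        n∸s : n ∸ s ≡ suc ν
        n∸s = ℕ.+-∸-assoc 1 s<n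
        k≡ : k ≡ suc s ℕ.+ κ
        k≡ = ≡.sym (ℕ.m+[n∸m]≡n s<k)
        n≡ : n ≡ suc s ℕ.+ ν
        n≡ = ≡.sym (ℕ.m+[n∸m]≡n s<n)
      last : X (suc k) ≈ - C (suc k)
      last = begin
        cf * summand (suc k) (k ∸ k) ν
          ≡⟨ ≡.cong (λ m → cf * summand (suc k) m ν) (ℕ.n∸n≡0 k) ⟩
        cf * summand (suc k) 0 ν
          ≈⟨ wz-last k ν (≡.subst (_≤ R) (≡.trans (≡.cong (ℕ._+ suc k) n≡) (level-last k ν)) bound)
               refl (trans (reflexive (≡.cong (q ^_) n≡)) (^-+ q k (suc ν))) ⟩
        - certificate k 0 (suc ν)
          ≡⟨ ≡.cong₂ (λ a c → - certificate k a c) (ℕ.n∸n≡0 k) n∸k ⟨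
        - C (suc k) ∎
        where
        ν = n ∸ suc k
        n∸k : n ∸ k ≡ suc ν
        n∸k = ℕ.+-∸-assoc 1 k<n
        n≡ : n ≡ k ℕ.+ suc ν
        n≡ = ≡.trans (≡.sym (ℕ.m+[n∸m]≡n (ℕ.<⇒≤ k<n))) (≡.cong (k ℕ.+_) n∸k)

    summand-sum : ∀ n k → n ℕ.+ k ≤ R → sumTo (k ⊓ n) (λ i → summand i (k ∸ i) (n ∸ i)) ≈ closedForm n k
    summand-sum n k bound with ℕ.≤-total k n
    ... | inj₁ k≤n = begin
      sumTo (k ⊓ n) (λ i → summand i (k ∸ i) (n ∸ i))
        ≡⟨ ≡.cong (λ m → sumTo m (λ i → summand i (k ∸ i) (n ∸ i))) (ℕ.m≤n⇒m⊓n≡m k≤n) ⟩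
      sumTo k (λ i → summand i (k ∸ i) (n ∸ i))         ≈⟨ summand-sum-≤ n k k≤n bound ⟩
      closedForm n k                                     ∎
    ... | inj₂ n≤k = begin
      sumTo (k ⊓ n) (λ i → summand i (k ∸ i) (n ∸ i))
        ≡⟨ ≡.cong (λ m → sumTo m (λ i → summand i (k ∸ i) (n ∸ i))) (ℕ.m≥n⇒m⊓n≡n n≤k) ⟩
      sumTo n (λ i → summand i (k ∸ i) (n ∸ i))         ≈⟨ sumTo-cong n (λ i i≤n → summand-symmetric i (k ∸ i) (n ∸ i)
                                                             (≡.subst (_≤ R) (level i≤n (ℕ.≤-trans i≤n n≤k)) bound)) ⟩
      sumTo n (λ i → summand i (n ∸ i) (k ∸ i))         ≈⟨ summand-sum-≤ k n n≤k (≡.subst (_≤ R) (ℕ.+-comm n k) bound) ⟩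
      closedForm k n                                     ≈⟨ closedForm-symmetric n k bound ⟨
      closedForm n k                                     ∎
      where
      level : ∀ {i} → i ≤ n → i ≤ k → n ℕ.+ k ≡ i ℕ.+ i ℕ.+ (k ∸ i) ℕ.+ (n ∸ i)
      level {i} i≤n i≤k = ≡.trans (≡.sym (≡.cong₂ ℕ._+_ (ℕ.m+[n∸m]≡n i≤n) (ℕ.m+[n∸m]≡n i≤k))) (regroup i (n ∸ i) (k ∸ i))
        where
        regroup : ∀ i a c → i ℕ.+ a ℕ.+ (i ℕ.+ c) ≡ i ℕ.+ i ℕ.+ c ℕ.+ a
        regroup i a c = ℕ-solve (i ∷ a ∷ c ∷ [])

module Expansions {c ℓ : Level} (F : Field c ℓ) where

  open Field F
  open FieldOps F
  open FieldProperties F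

  module Sides (q u v x y : Carrier) (r : ℕ) (q≉0 : q ≉0) (u≉0 : u ≉0) (x≉0 : x ≉0) (y≉0 : y ≉0)
    (hQ : ∀ k → k ≤ r → poch q q k ≉0)
    (hA : ∀ k → k ≤ r → poch q ((q * qneg q r) ÷ (u * x)) k ≉0)
    (hB : ∀ i → i ≤ ⌊ r /2⌋ → ∀ k → k ≤ r ∸ 2 ℕ.* i → poch q ((q * qneg q (r ∸ 2 ℕ.* i)) ÷ (u * y)) k ≉0)
    (hC : ∀ i → i ≤ ⌊ r /2⌋ → poch q (u * x * q ^ (r ∸ i)) i ≉0 × poch q (u * y * q ^ (r ∸ 2 ℕ.* i ℕ.+ 1)) i ≉0)
    where

    open Powers F
    open FiniteSums F
    open Pochhammer F q
    open Reversal F q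
    open WZPair F q (u * y) (x ÷ y)
    open import Relation.Binary.Reasoning.Setoid setoid

    private
      b = u * y
      t = v ÷ u
      U = poch q u r

      A≈ux : A ≈ u * x
      A≈ux = begin
        u * y * (x * y ⁻¹)    ≈⟨ rearrange 4 (λ u y x y′ → u ∙ y ∙ (x ∙ y′) ≣ u ∙ x ∙ (y ∙ y′)) refl u y x (y ⁻¹) ⟩
        u * x * (y * y ⁻¹)    ≈⟨ *-congˡ (⁻¹-inverse y y≉0) ⟩
        u * x * 1#            ≈⟨ *-identityʳ (u * x) ⟩
        u * x                 ∎

      ux-reg : Regular (u * x) r
      ux-reg = reversed-regular r q≉0 (*-≉0 u≉0 x≉0) (hA r ℕ.≤-refl)

      yv≈bt : ∀ i → y ^ i * v ^ i ≈ b ^ i * t ^ i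
      yv≈bt i = sym (begin
        (u * y) ^ i * (v * u ⁻¹) ^ i              ≈⟨ *-cong (^-distrib-* u y i) (^-distrib-* v (u ⁻¹) i) ⟩
        u ^ i * y ^ i * (v ^ i * (u ⁻¹) ^ i)      ≈⟨ rearrange 4 (λ a b c d → a ∙ b ∙ (c ∙ d) ≣ b ∙ c ∙ (a ∙ d))
                                                       refl (u ^ i) (y ^ i) (v ^ i) ((u ⁻¹) ^ i) ⟩
        y ^ i * v ^ i * (u ^ i * (u ⁻¹) ^ i)      ≈⟨ *-congˡ (sym (^-distrib-* u (u ⁻¹) i)) ⟩
        y ^ i * v ^ i * (u * u ⁻¹) ^ i            ≈⟨ *-congˡ (trans (^-cong i (⁻¹-inverse u u≉0)) (1^n≈1 i)) ⟩
        y ^ i * v ^ i * 1#                        ≈⟨ *-identityʳ _ ⟩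
        y ^ i * v ^ i                             ∎)

    open Regularity r (poch-factor-≉0 q r (hQ r ℕ.≤-refl))
               (reversed-regular r q≉0 (*-≉0 u≉0 y≉0) (hB 0 z≤n r ℕ.≤-refl))
               (regular-cong (sym A≈ux) ux-reg)

    lhs-expansion : (U ÷ poch q q r) * phi21 q (qneg q r) (u * x) ((q * qneg q r) ÷ (u * x)) ((q * v) ÷ (u * u * x)) r
      ≈ sumTo r (λ k → U * t ^ k * closedForm (r ∸ k) k)
    lhs-expansion = trans (TerminatingPhi21.phi21-reversal u v x r q≉0 u≉0 x≉0 hQ hA)
      (sumTo-cong r (λ k k≤r → *-congˡ (÷-cong
        (*-≉0 (*-≉0 (hQ k k≤r) (hQ (r ∸ k) (ℕ.m∸n≤m r k)))
              (regular-poch-≉0 (r ∸ k) k ux-reg (ℕ.≤-reflexive (ℕ.m∸n+n≡m k≤r)) refl))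
        (poch-cong k (sym A≈ux))
        (*-congˡ (poch-cong k (*-congʳ (sym A≈ux)))))))

    module _ (i : ℕ) (i≤h : i ≤ ⌊ r /2⌋) where

      private
        m = r ∸ 2 ℕ.* i
        2i≤r : 2 ℕ.* i ≤ r
        2i≤r = m≤⌊n/2⌋⇒2*m≤n i≤h
        m≤r : m ≤ r
        m≤r = ℕ.m∸n≤m r (2 ℕ.* i)
        module Φ = TerminatingPhi21 u v y m q≉0 u≉0 y≉0 (λ j j≤m → hQ j (ℕ.≤-trans j≤m m≤r)) (hB i i≤h)
        b-reg : Regular b m
        b-reg = reversed-regular m q≉0 (*-≉0 u≉0 y≉0) (hB i i≤h m ℕ.≤-refl)

      weight : Carrier
      weight = y ^ i * v ^ i * (poch q (x ÷ y) i ÷ poch q q i)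
        * (poch q (u * q ^ m) (2 ℕ.* i) ÷ (poch q (u * x * q ^ (r ∸ i)) i * poch q (u * y * q ^ (m ℕ.+ 1)) i))

      rhs-summand : ∀ j → j ≤ m →
        poch q u m * t ^ j * (poch q b j ÷ (poch q q j * poch q q (m ∸ j) * poch q (b * q ^ (m ∸ j)) j)) * weight
          ≈ U * t ^ (i ℕ.+ j) * summand i j (m ∸ j)
      rhs-summand j j≤m = begin
        Um * t ^ j * (Pb ÷ D₁) * (y ^ i * v ^ i * (Pw ÷ Qi) * (Pu ÷ (PX′ * PY′)))
          ≈⟨ *-congˡ (*-cong (*-congʳ (yv≈bt i)) (÷-cong PXY′≉0 refl (*-cong PX≈ PY≈))) ⟩
        Um * t ^ j * (Pb ÷ D₁) * (b ^ i * t ^ i * (Pw ÷ Qi) * (Pu ÷ (PX * PY)))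
          ≈⟨ rearrange 7 (λ Um tj F₁ bi ti F₂ F₃ →
                Um ∙ tj ∙ F₁ ∙ (bi ∙ ti ∙ F₂ ∙ F₃) ≣ ti ∙ tj ∙ Um ∙ bi ∙ (F₁ ∙ F₂ ∙ F₃))
               refl Um (t ^ j) (Pb ÷ D₁) (b ^ i) (t ^ i) (Pw ÷ Qi) (Pu ÷ (PX * PY)) ⟩
        t ^ i * t ^ j * Um * b ^ i * ((Pb ÷ D₁) * (Pw ÷ Qi) * (Pu ÷ (PX * PY)))
          ≈⟨ *-congˡ (trans (*-congʳ (÷-*-÷ Pb Pw D₁≉0 Qi≉0)) (÷-*-÷ (Pb * Pw) Pu (*-≉0 D₁≉0 Qi≉0) PXY≉0)) ⟩
        t ^ i * t ^ j * Um * b ^ i * ((Pb * Pw * Pu) * (D₁ * Qi * (PX * PY)) ⁻¹)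
          ≈⟨ rearrange 8 (λ ti tj Um bi Pb Pw Pu D′ →
                ti ∙ tj ∙ Um ∙ bi ∙ (Pb ∙ Pw ∙ Pu ∙ D′) ≣ ti ∙ tj ∙ (Um ∙ Pu) ∙ (bi ∙ Pw ∙ Pb ∙ D′))
               refl (t ^ i) (t ^ j) Um (b ^ i) Pb Pw Pu ((D₁ * Qi * (PX * PY)) ⁻¹) ⟩
        t ^ i * t ^ j * (Um * Pu) * ((b ^ i * Pw * Pb) ÷ (D₁ * Qi * (PX * PY)))
          ≈⟨ *-cong (*-cong (sym (^-+ t i j)) Um*Pu≈U) (÷-cong D≉0 refl D≈) ⟩
        t ^ (i ℕ.+ j) * U * summand i j ν
          ≈⟨ *-congʳ (*-comm (t ^ (i ℕ.+ j)) U) ⟩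
        U * t ^ (i ℕ.+ j) * summand i j ν ∎
        where
        ν = m ∸ j
        Um = poch q u m
        Pb = poch q b j
        D₁ = poch q q j * poch q q ν * poch q (b * q ^ ν) j
        Pw = poch q (x ÷ y) i
        Qi = poch q q i
        Pu = poch q (u * q ^ m) (2 ℕ.* i)
        PX′ = poch q (u * x * q ^ (r ∸ i)) i
        PY′ = poch q (u * y * q ^ (m ℕ.+ 1)) i
        PX = poch q (A * (q ^ i * q ^ j * q ^ ν)) i
        PY = poch q (b * (q ^ j * q ^ ν * q)) i
        j+ν≡m : j ℕ.+ ν ≡ m
        j+ν≡m = ℕ.m+[n∸m]≡n j≤m
        PX≈ : PX′ ≈ PX
        PX≈ = poch-cong i (*-cong (sym A≈ux) (trans (reflexive (≡.cong (q ^_) (∸-half {i} {j} {ν} 2i≤r j+ν≡m)))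
                (trans (^-+ q (i ℕ.+ j) ν) (*-congʳ (^-+ q i j)))))
        PY≈ : PY′ ≈ PY
        PY≈ = poch-cong i (*-congˡ (trans (reflexive (≡.cong (λ e → q ^ (e ℕ.+ 1)) (≡.sym j+ν≡m)))
                (trans (^-+ q (j ℕ.+ ν) 1) (*-cong (^-+ q j ν) (*-identityʳ q)))))
        Um*Pu≈U : Um * Pu ≈ U
        Um*Pu≈U = trans (sym (poch-+ u m (2 ℕ.* i))) (reflexive (≡.cong (poch q u) (ℕ.m∸n+n≡m 2i≤r)))
        Qi≉0 : Qi ≉0
        Qi≉0 = hQ i (ℕ.≤-trans (ℕ.m≤m+n i (i ℕ.+ 0)) 2i≤r)
        D₁≉0 : D₁ ≉0
        D₁≉0 = *-≉0 (*-≉0 (hQ j (ℕ.≤-trans j≤m m≤r)) (hQ ν (ℕ.≤-trans (ℕ.m∸n≤m m j) m≤r)))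
                    (regular-poch-≉0 ν j b-reg (ℕ.≤-reflexive (ℕ.m∸n+n≡m j≤m)) refl)
        PXY′≉0 : PX′ * PY′ ≉0
        PXY′≉0 = *-≉0 (proj₁ (hC i i≤h)) (proj₂ (hC i i≤h))
        PXY≉0 : PX * PY ≉0
        PXY≉0 = ≉0-resp (*-cong PX≈ PY≈) PXY′≉0
        D≉0 : D₁ * Qi * (PX * PY) ≉0
        D≉0 = *-≉0 (*-≉0 D₁≉0 Qi≉0) PXY≉0
        D≈ : D₁ * Qi * (PX * PY) ≈ denominator i j ν
        D≈ = rearrange 6 (λ Qj Qν Bν Qi PX PY → Qj ∙ Qν ∙ Bν ∙ Qi ∙ (PX ∙ PY) ≣ Qi ∙ Qj ∙ Qν ∙ Bν ∙ PX ∙ PY)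
               refl (poch q q j) (poch q q ν) (poch q (b * q ^ ν) j) Qi PX PY

      rhs-term :
        (poch q u m ÷ poch q q m) * phi21 q (qneg q m) (u * y) ((q * qneg q m) ÷ (u * y)) ((q * v) ÷ (u * u * y)) m
          * (y ^ i * v ^ i) * (poch q (x ÷ y) i ÷ poch q q i)
          * (poch q (u * q ^ m) (2 ℕ.* i) ÷ (poch q (u * x * q ^ (r ∸ i)) i * poch q (u * y * q ^ (m ℕ.+ 1)) i))
        ≈ sumTo m (λ j → U * t ^ (i ℕ.+ j) * summand i j (m ∸ j))
      rhs-term = begin
        C * φ * Y₁ * Y₂ * Y₃                     ≈⟨ rearrange 5 (λ C φ Y₁ Y₂ Y₃ → C ∙ φ ∙ Y₁ ∙ Y₂ ∙ Y₃ ≣ C ∙ φ ∙ (Y₁ ∙ Y₂ ∙ Y₃))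
                                                      refl C φ Y₁ Y₂ Y₃ ⟩
        C * φ * weight                           ≈⟨ *-congʳ Φ.phi21-reversal ⟩
        sumTo m T * weight                       ≈⟨ sumTo-*ʳ weight T m ⟩
        sumTo m (λ j → T j * weight)             ≈⟨ sumTo-cong m rhs-summand ⟩
        sumTo m (λ j → U * t ^ (i ℕ.+ j) * summand i j (m ∸ j)) ∎
        where
        C = poch q u m ÷ poch q q m
        φ = phi21 q (qneg q m) (u * y) ((q * qneg q m) ÷ (u * y)) ((q * v) ÷ (u * u * y)) m
        Y₁ = y ^ i * v ^ i
        Y₂ = poch q (x ÷ y) i ÷ poch q q i
        Y₃ = poch q (u * q ^ m) (2 ℕ.* i) ÷ (poch q (u * x * q ^ (r ∸ i)) i * poch q (u * y * q ^ (m ℕ.+ 1)) i)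
        T : ℕ → Carrier
        T j = poch q u m * t ^ j * (poch q b j ÷ (poch q q j * poch q q (m ∸ j) * poch q (b * q ^ (m ∸ j)) j))

    rhs-expansion :
      sumTo ⌊ r /2⌋ (λ i →
        (poch q u (r ∸ 2 ℕ.* i) ÷ poch q q (r ∸ 2 ℕ.* i))
        * phi21 q (qneg q (r ∸ 2 ℕ.* i)) (u * y) ((q * qneg q (r ∸ 2 ℕ.* i)) ÷ (u * y))
                ((q * v) ÷ (u * u * y)) (r ∸ 2 ℕ.* i)
        * (y ^ i * v ^ i)
        * (poch q (x ÷ y) i ÷ poch q q i)
        * (poch q (u * q ^ (r ∸ 2 ℕ.* i)) (2 ℕ.* i)
           ÷ (poch q (u * x * q ^ (r ∸ i)) i * poch q (u * y * q ^ (r ∸ 2 ℕ.* i ℕ.+ 1)) i)))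
      ≈ sumTo r (λ k → U * t ^ k * sumTo (k ⊓ (r ∸ k)) (λ i → summand i (k ∸ i) ((r ∸ k) ∸ i)))
    rhs-expansion = begin
      _                                                                        ≈⟨ sumTo-cong ⌊ r /2⌋ rhs-term ⟩
      sumTo ⌊ r /2⌋ (λ i → sumTo (r ∸ 2 ℕ.* i) (λ j → U * t ^ (i ℕ.+ j) * summand i j ((r ∸ 2 ℕ.* i) ∸ j)))
        ≈⟨ sumTo-cong ⌊ r /2⌋ (λ i _ → sumTo-cong (r ∸ 2 ℕ.* i) (λ j _ → reflexive (≡.cong₂ (λ κ ν → U * t ^ (i ℕ.+ j) * summand i κ ν)
             (≡.sym (ℕ.m+n∸m≡n i j)) (remaining i j)))) ⟩
      sumTo ⌊ r /2⌋ (λ i → sumTo (r ∸ 2 ℕ.* i) (λ j → f i (i ℕ.+ j)))      ≈⟨ sumTo-strips f r ⟩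
      sumTo r (λ k → sumTo (k ⊓ (r ∸ k)) (λ i → f i k))                      ≈⟨ sumTo-cong r (λ k _ → sumTo-*ˡ (U * t ^ k) _ (k ⊓ (r ∸ k))) ⟨
      sumTo r (λ k → U * t ^ k * sumTo (k ⊓ (r ∸ k)) (λ i → summand i (k ∸ i) ((r ∸ k) ∸ i))) ∎
      where
      f : ℕ → ℕ → Carrier
      f i k = U * t ^ k * summand i (k ∸ i) ((r ∸ k) ∸ i)
      remaining : ∀ i j → (r ∸ 2 ℕ.* i) ∸ j ≡ (r ∸ (i ℕ.+ j)) ∸ i
      remaining i j = ≡.trans (ℕ.∸-+-assoc r (2 ℕ.* i) j) (≡.trans (≡.cong (r ∸_) (regroup i j)) (≡.sym (ℕ.∸-+-assoc r (i ℕ.+ j) i)))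
        where
        regroup : ∀ i j → 2 ℕ.* i ℕ.+ j ≡ i ℕ.+ j ℕ.+ i
        regroup i j = ℕ-solve (i ∷ j ∷ [])

    core-identity : ∀ k → k ≤ r →
      sumTo (k ⊓ (r ∸ k)) (λ i → summand i (k ∸ i) ((r ∸ k) ∸ i)) ≈ closedForm (r ∸ k) k
    core-identity k k≤r = summand-sum (r ∸ k) k (ℕ.≤-reflexive (ℕ.m∸n+n≡m k≤r))

theorem1 : ∀ {c ℓ : Level} (F : Field c ℓ) →
  let open Field F
      open FieldOps F
  in
  (q u v x y : Carrier) (r : ℕ) →
  ¬ (q ≈ 0#) → ¬ (u ≈ 0#) → ¬ (x ≈ 0#) → ¬ (y ≈ 0#) →
  (∀ k → k ≤ r → ¬ (poch q q k ≈ 0#)) →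
  (∀ k → k ≤ r → ¬ (poch q ((q * qneg q r) ÷ (u * x)) k ≈ 0#)) →
  (∀ i → i ≤ ⌊ r /2⌋ → ∀ k → k ≤ r ℕ.∸ 2 ℕ.* i →
    ¬ (poch q ((q * qneg q (r ℕ.∸ 2 ℕ.* i)) ÷ (u * y)) k ≈ 0#)) →
  (∀ i → i ≤ ⌊ r /2⌋ →
    ¬ (poch q (u * x * q ^ (r ℕ.∸ i)) i ≈ 0#)
    × ¬ (poch q (u * y * q ^ (r ℕ.∸ 2 ℕ.* i ℕ.+ 1)) i ≈ 0#)) →
  (poch q u r ÷ poch q q r)
    * phi21 q (qneg q r) (u * x) ((q * qneg q r) ÷ (u * x)) ((q * v) ÷ (u * u * x)) r
  ≈ sumTo ⌊ r /2⌋ (λ i →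
      (poch q u (r ℕ.∸ 2 ℕ.* i) ÷ poch q q (r ℕ.∸ 2 ℕ.* i))
      * phi21 q (qneg q (r ℕ.∸ 2 ℕ.* i)) (u * y)
              ((q * qneg q (r ℕ.∸ 2 ℕ.* i)) ÷ (u * y))
              ((q * v) ÷ (u * u * y)) (r ℕ.∸ 2 ℕ.* i)
      * (y ^ i * v ^ i)
      * (poch q (x ÷ y) i ÷ poch q q i)
      * (poch q (u * q ^ (r ℕ.∸ 2 ℕ.* i)) (2 ℕ.* i)
         ÷ (poch q (u * x * q ^ (r ℕ.∸ i)) i
            * poch q (u * y * q ^ (r ℕ.∸ 2 ℕ.* i ℕ.+ 1)) i)))
theorem1 F q u v x y r q≉0 u≉0 x≉0 y≉0 hQ hA hB hC = begin
  _   ≈⟨ lhs-expansion ⟩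
  sumTo r (λ k → poch q u r * (v ÷ u) ^ k * closedForm (r ∸ k) k)
      ≈⟨ sumTo-cong r (λ k k≤r → *-congˡ (core-identity k k≤r)) ⟨
  sumTo r (λ k → poch q u r * (v ÷ u) ^ k * sumTo (k ⊓ (r ∸ k)) (λ i → summand i (k ∸ i) ((r ∸ k) ∸ i)))
      ≈⟨ rhs-expansion ⟨
  _   ∎
  where
  open Field F
  open FieldOps F
  open FiniteSums F
  open WZPair F q (u * y) (x ÷ y) using (summand; closedForm)
  open Expansions F
  open Sides q u v x y r q≉0 u≉0 x≉0 y≉0 hQ hA hB hC
  open import Relation.Binary.Reasoning.Setoid setoid
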